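{- For all integers $\alpha\geq 0$, $m\geq 0$ and $n\geq 0$, $$\overline a_{2m+1}(8\cdot 5^{2\alpha}n+5^{2\alpha})\equiv \overline a_{2m+1}(8n+1)\pmod 8,$$ $$\overline a_{2m+1}(8\cdot 5^{2\alpha+1}n+17\cdot 5^{2\alpha})\equiv 0\pmod 8,$$ $$\overline a_{2m+1}(8\cdot 5^{2\alpha+1}n+33\cdot 5^{2\alpha})\equiv 0\pmod 8.$$
   Context: For $|q|<1$ and a positive integer $h$, write $f_h=(q^h;q^h)_\infty=\prod_{k\geq 1}(1-q^{hk})$. For a positive integer $c$, the generalized overcubic partition function $\overline a_c(n)$ is defined by the generating function $\sum_{n\geq 0}\overline a_c(n)q^n=\dfrac{f_4^{c-1}}{f_1^2f_2^{2c-3}}$. -}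

module Defs where

open import Data.Nat as ℕ using (ℕ; zero; suc; _∸_)
open import Data.Nat.Divisibility using (_∣?_)
open import Data.Integer as ℤ using (ℤ; +_; -[1+_]; _+_; _*_; -_; _-_)
open import Data.Integer.Divisibility using (_∣_)
open import Relation.Nullary using (yes; no)

-- Formal power series in q with integer coefficients: n ↦ coefficient of q^n.
Series : Set
Series = ℕ → ℤ

sumTo : ℕ → (ℕ → ℤ) → ℤ
sumTo zero g = g zero
sumTo (suc n) g = sumTo n g + g (suc n)

infixl 7 _⊛_
_⊛_ : Series → Series → Series
(a ⊛ b) n = sumTo n (λ i → a i * b (n ∸ i))

one : Series
one zero = + 1
one (suc _) = + 0

-- the polynomial 1 - q^a  (a ≥ 1 in all uses)
oneMinusQ : ℕ → Series
oneMinusQ a zero = + 1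
oneMinusQ a (suc n) with suc n ℕ.≟ a
... | yes _ = -[1+ 0 ]
... | no _ = + 0

-- the series 1/(1 - q^a) = Σ_j q^{aj}  (a ≥ 1 in all uses)
geom : ℕ → Series
geom a n with a ∣? n
... | yes _ = + 1
... | no _ = + 0

prodTo : ℕ → (ℕ → Series) → Series
prodTo zero F = one
prodTo (suc N) F = prodTo N F ⊛ F (suc N)

-- f_h = ∏_{k≥1} (1 - q^{hk}); for h ≥ 1 the coefficient of q^n only
-- depends on the factors with k ≤ n.
f : ℕ → Series
f h n = prodTo n (λ k → oneMinusQ (h ℕ.* k)) n

-- 1/f_h = ∏_{k≥1} 1/(1 - q^{hk})
finv : ℕ → Series
finv h n = prodTo n (λ k → geom (h ℕ.* k)) n

pow : Series → ℕ → Series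
pow s zero = one
pow s (suc e) = pow s e ⊛ s

zpow : Series → Series → ℤ → Series
zpow s sinv (+ e) = pow s e
zpow s sinv -[1+ e ] = pow sinv (suc e)

-- generalized overcubic partition function:
-- Σ ā_c(n) q^n = f_4^{c-1} / (f_1^2 f_2^{2c-3}) = f_4^{c-1} · (1/f_1)^2 · f_2^{3-2c}
abar : ℕ → ℕ → ℤ
abar c = pow (f 4) (c ∸ 1) ⊛ pow (finv 1) 2 ⊛ zpow (f 2) (finv 2) (+ 3 - + (2 ℕ.* c))

_≡_[mod_] : ℤ → ℤ → ℕ → Set
x ≡ y [mod k ] = (+ k) ∣ (x - y)

{-# OPTIONS --safe #-}
-- The generating function of ā_{2m+1} is (f₂/f₁²) (f₄²/f₂⁴)^m. Gauss's identity f₁²/f₂ = θ = 1 + 2S,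
-- with S = Σ_{j≥1} (-1)^j q^{j²}, gives f₂/f₁² ≡ 1 - 2S + 4S² (mod 8), and f₄ ≡ f₂² (mod 2) makes
-- f₄²/f₂⁴ a series in q² that is ≡ 1 (mod 4). At an odd exponent n the series in q² contribute
-- nothing and the coefficient of S² is even (its Cauchy terms pair up), so ā_{2m+1}(n) ≡ -2 S_n (mod 8):
-- it is ≡ 2 when n is a square and ≡ 0 otherwise. As 5 is prime, 5^{2α} N is a square exactly when N
-- is, and 40n + 17, 40n + 33 are ≡ 2, 3 (mod 5), hence not squares; the three congruences follow.
-- Gauss's identity is the finite Jacobi triple product
--   ∏_{k=1}^N (1 + z q^{2k-1}) (1 + z⁻¹ q^{2k-1}) = Σ_{|j|≤N} z^j q^{j²} [2N choose N+j]_{q²}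
-- at z = -1, multiplied by (q²;q²)_N and read modulo q^{2N+1}.
module Submission where

open import Defs
open import Data.Nat as ℕ using (ℕ; zero; suc; _+_; _*_; _^_; _∸_; _≤_; _<_; z≤n; s≤s)
import Data.Nat.Properties as ℕP
open import Data.Integer as ℤ using (ℤ; +_)
import Data.Integer.Properties as ℤP
open import Data.Product using (_×_; _,_; proj₁; proj₂; ∃-syntax)
open import Data.Sum using (_⊎_; inj₁; inj₂; reduce)
open import Data.Empty using (⊥-elim)
open import Data.Maybe using (Maybe; just; nothing)
open import Data.Nat.DivMod using (_%_; %-distribˡ-*; [m+kn]%n≡m%n; m%n<n)
open import Data.Nat.Primality using (Prime; prime?; euclidsLemma)
open import Relation.Nullary.Decidable using (from-yes)
open import Relation.Binary.Definitions using (tri<; tri≈; tri>)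
open import Data.List using (_∷_; [])
open import Data.Nat.Divisibility as ND using (_∣_; _∣?_)
open import Relation.Nullary using (Dec; yes; no; ¬_)
open import Relation.Binary.PropositionalEquality hiding (J)
open import Algebra.Bundles using (CommutativeRing)
open import Relation.Binary.Bundles using (Setoid)
open import Algebra.Structures using (IsCommutativeRing)
import Algebra.Solver.Ring
import Algebra.Solver.Ring.AlmostCommutativeRing as ACR
import Data.Nat.Tactic.RingSolver as ℕ-Solver
import Data.Integer.Tactic.RingSolver as ℤ-Solver
import Data.Integer.Divisibility.Signed as ℤ∣
open ℤ∣ using () renaming (_∣_ to _∣ℤ_)
import Relation.Binary.Reasoning.Setoid as SetoidReasoning
open import Algebra.Properties.CommutativeSemigroup ℤP.+-commutativeSemigroup
  using () renaming (interchange to ℤ+-interchange)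
open import Function using (_∘_)

-- Finite sums

sumTo-cong : ∀ n {g h : ℕ → ℤ} → (∀ i → i ≤ n → g i ≡ h i) → sumTo n g ≡ sumTo n h
sumTo-cong zero     g≡h = g≡h 0 z≤n
sumTo-cong (suc n) g≡h =
  cong₂ ℤ._+_ (sumTo-cong n (λ i i≤n → g≡h i (ℕP.m≤n⇒m≤1+n i≤n))) (g≡h (suc n) ℕP.≤-refl)

sumTo-zero : ∀ n {g : ℕ → ℤ} → (∀ i → i ≤ n → g i ≡ + 0) → sumTo n g ≡ + 0
sumTo-zero n {g} g≡0 = trans (sumTo-cong n g≡0) (zeros n)
  where
  zeros : ∀ n → sumTo n (λ _ → + 0) ≡ + 0
  zeros zero    = refl
  zeros (suc n) = cong (ℤ._+ + 0) (zeros n)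

sumTo-+ : ∀ n (g h : ℕ → ℤ) → sumTo n (λ i → g i ℤ.+ h i) ≡ sumTo n g ℤ.+ sumTo n h
sumTo-+ zero    g h = refl
sumTo-+ (suc n) g h = begin
  sumTo n (λ i → g i ℤ.+ h i) ℤ.+ (g (suc n) ℤ.+ h (suc n))
    ≡⟨ cong (ℤ._+ (g (suc n) ℤ.+ h (suc n))) (sumTo-+ n g h) ⟩
  (sumTo n g ℤ.+ sumTo n h) ℤ.+ (g (suc n) ℤ.+ h (suc n))
    ≡⟨ ℤ+-interchange (sumTo n g) (sumTo n h) (g (suc n)) (h (suc n)) ⟩
  (sumTo n g ℤ.+ g (suc n)) ℤ.+ (sumTo n h ℤ.+ h (suc n)) ∎
  where open ≡-Reasoning

sumTo-*ˡ : ∀ n c (g : ℕ → ℤ) → sumTo n (λ i → c ℤ.* g i) ≡ c ℤ.* sumTo n g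
sumTo-*ˡ zero    c g = refl
sumTo-*ˡ (suc n) c g =
  trans (cong (ℤ._+ c ℤ.* g (suc n)) (sumTo-*ˡ n c g)) (sym (ℤP.*-distribˡ-+ c (sumTo n g) (g (suc n))))

sumTo-*ʳ : ∀ n c (g : ℕ → ℤ) → sumTo n (λ i → g i ℤ.* c) ≡ sumTo n g ℤ.* c
sumTo-*ʳ n c g = begin
  sumTo n (λ i → g i ℤ.* c) ≡⟨ sumTo-cong n (λ i _ → ℤP.*-comm (g i) c) ⟩
  sumTo n (λ i → c ℤ.* g i) ≡⟨ sumTo-*ˡ n c g ⟩
  c ℤ.* sumTo n g           ≡⟨ ℤP.*-comm c _ ⟩
  sumTo n g ℤ.* c           ∎
  where open ≡-Reasoning

sumTo-suc : ∀ n (g : ℕ → ℤ) → sumTo (suc n) g ≡ g 0 ℤ.+ sumTo n (λ i → g (suc i))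
sumTo-suc zero    g = refl
sumTo-suc (suc n) g =
  trans (cong (ℤ._+ g (suc (suc n))) (sumTo-suc n g)) (ℤP.+-assoc (g 0) _ _)

sumTo-split : ∀ a b (g : ℕ → ℤ) → sumTo (a + suc b) g ≡ sumTo a g ℤ.+ sumTo b (λ i → g (suc a + i))
sumTo-split a zero g rewrite ℕP.+-comm a 1 | ℕP.+-identityʳ a = refl
sumTo-split a (suc b) g rewrite ℕP.+-suc a (suc b) | sumTo-split a b g = ℤP.+-assoc (sumTo a g) _ _

sumTo-reverse : ∀ n (g : ℕ → ℤ) → sumTo n g ≡ sumTo n (λ i → g (n ∸ i))
sumTo-reverse zero    g = refl
sumTo-reverse (suc n) g = begin
  sumTo n g ℤ.+ g (suc n)                 ≡⟨ cong (ℤ._+ g (suc n)) (sumTo-reverse n g) ⟩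
  sumTo n (λ i → g (n ∸ i)) ℤ.+ g (suc n) ≡⟨ ℤP.+-comm _ (g (suc n)) ⟩
  g (suc n) ℤ.+ sumTo n (λ i → g (n ∸ i)) ≡⟨ sumTo-suc n (λ i → g (suc n ∸ i)) ⟨
  sumTo (suc n) (λ i → g (suc n ∸ i))     ∎
  where open ≡-Reasoning

sumTo-single : ∀ n a {g : ℕ → ℤ} → (∀ i → i ≢ a → g i ≡ + 0) → a ≤ n → sumTo n g ≡ g a
sumTo-single zero    a g≡0 z≤n = refl
sumTo-single (suc n) a {g} g≡0 a≤1+n with a ℕ.≟ suc n
... | yes refl = trans (cong (ℤ._+ g (suc n)) (sumTo-zero n (λ i i≤n → g≡0 i (ℕP.<⇒≢ (s≤s i≤n)))))
                       (ℤP.+-identityˡ _)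
... | no a≢1+n = trans (cong₂ ℤ._+_ (sumTo-single n a g≡0 (ℕP.≤-pred (ℕP.≤∧≢⇒< a≤1+n a≢1+n)))
                                    (g≡0 (suc n) (a≢1+n ∘ sym)))
                       (ℤP.+-identityʳ _)

sumTo-triangle : ∀ n (F : ℕ → ℕ → ℤ) →
  sumTo n (λ i → sumTo i (λ j → F j i)) ≡ sumTo n (λ j → sumTo (n ∸ j) (λ k → F j (j + k)))
sumTo-triangle zero    F = refl
sumTo-triangle (suc n) F = begin
  sumTo n (λ i → sumTo i (λ j → F j i)) ℤ.+ (sumTo n (λ j → F j (suc n)) ℤ.+ F (suc n) (suc n))
    ≡⟨ cong (ℤ._+ (sumTo n (λ j → F j (suc n)) ℤ.+ F (suc n) (suc n))) (sumTo-triangle n F) ⟩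
  rows n ℤ.+ (sumTo n (λ j → F j (suc n)) ℤ.+ F (suc n) (suc n))
    ≡⟨ ℤP.+-assoc (rows n) _ _ ⟨
  (rows n ℤ.+ sumTo n (λ j → F j (suc n))) ℤ.+ F (suc n) (suc n)
    ≡⟨ cong₂ ℤ._+_ (sym (sumTo-+ n _ _)) lastRow ⟩
  sumTo n (λ j → sumTo (n ∸ j) (λ k → F j (j + k)) ℤ.+ F j (suc n)) ℤ.+ sumTo (n ∸ n) (λ k → F (suc n) (suc n + k))
    ≡⟨ cong (ℤ._+ sumTo (n ∸ n) (λ k → F (suc n) (suc n + k))) (sumTo-cong n extendRow) ⟩
  sumTo n (λ j → sumTo (suc n ∸ j) (λ k → F j (j + k))) ℤ.+ sumTo (suc n ∸ suc n) (λ k → F (suc n) (suc n + k)) ∎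
  where
  open ≡-Reasoning
  rows : ℕ → ℤ
  rows n = sumTo n (λ j → sumTo (n ∸ j) (λ k → F j (j + k)))
  lastRow : F (suc n) (suc n) ≡ sumTo (n ∸ n) (λ k → F (suc n) (suc n + k))
  lastRow rewrite ℕP.n∸n≡0 n | ℕP.+-identityʳ n = refl
  extendRow : ∀ j → j ≤ n →
    sumTo (n ∸ j) (λ k → F j (j + k)) ℤ.+ F j (suc n) ≡ sumTo (suc n ∸ j) (λ k → F j (j + k))
  extendRow j j≤n rewrite ℕP.+-∸-assoc 1 j≤n =
    cong (λ x → sumTo (n ∸ j) (λ k → F j (j + k)) ℤ.+ F j x)
         (sym (trans (ℕP.+-suc j (n ∸ j)) (cong suc (ℕP.m+[n∸m]≡n j≤n))))

-- The ring of formal power series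

infix 4 _≈_
record _≈_ (s t : Series) : Set where
  constructor mk≈
  field at : ∀ n → s n ≡ t n
open _≈_ public

infixl 6 _⊕_
_⊕_ : Series → Series → Series
(s ⊕ t) n = s n ℤ.+ t n

infix 8 ⊝_
⊝_ : Series → Series
(⊝ s) n = ℤ.- s n

zeroˢ : Series
zeroˢ _ = + 0

κ : ℤ → Series
κ c zero    = c
κ c (suc _) = + 0

≈-refl : ∀ {s} → s ≈ s
≈-refl = mk≈ λ _ → refl

≈-sym : ∀ {s t} → s ≈ t → t ≈ s
≈-sym s≈t = mk≈ λ n → sym (at s≈t n)

≈-trans : ∀ {s t u} → s ≈ t → t ≈ u → s ≈ u
≈-trans s≈t t≈u = mk≈ λ n → trans (at s≈t n) (at t≈u n)

≡⇒≈ : ∀ {s t} → s ≡ t → s ≈ t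
≡⇒≈ refl = ≈-refl

⊕-cong : ∀ {s s′ t t′} → s ≈ s′ → t ≈ t′ → s ⊕ t ≈ s′ ⊕ t′
⊕-cong s≈s′ t≈t′ = mk≈ λ n → cong₂ ℤ._+_ (at s≈s′ n) (at t≈t′ n)

⊝-cong : ∀ {s s′} → s ≈ s′ → ⊝ s ≈ ⊝ s′
⊝-cong s≈s′ = mk≈ λ n → cong ℤ.-_ (at s≈s′ n)

⊛-cong : ∀ {s s′ t t′} → s ≈ s′ → t ≈ t′ → s ⊛ t ≈ s′ ⊛ t′
⊛-cong s≈s′ t≈t′ = mk≈ λ n → sumTo-cong n λ i _ → cong₂ ℤ._*_ (at s≈s′ i) (at t≈t′ (n ∸ i))

⊛-comm : ∀ s t → s ⊛ t ≈ t ⊛ s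
⊛-comm s t = mk≈ λ n → trans (sumTo-reverse n _) (sumTo-cong n λ i i≤n →
  trans (cong (λ j → s (n ∸ i) ℤ.* t j) (ℕP.m∸[m∸n]≡n i≤n)) (ℤP.*-comm (s (n ∸ i)) (t i)))

⊛-assoc : ∀ s t u → (s ⊛ t) ⊛ u ≈ s ⊛ (t ⊛ u)
⊛-assoc s t u = mk≈ λ n → begin
  sumTo n (λ i → sumTo i (λ j → s j ℤ.* t (i ∸ j)) ℤ.* u (n ∸ i))
    ≡⟨ sumTo-cong n (λ i _ → sym (sumTo-*ʳ i (u (n ∸ i)) _)) ⟩
  sumTo n (λ i → sumTo i (λ j → s j ℤ.* t (i ∸ j) ℤ.* u (n ∸ i)))
    ≡⟨ sumTo-triangle n (λ j i → s j ℤ.* t (i ∸ j) ℤ.* u (n ∸ i)) ⟩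
  sumTo n (λ j → sumTo (n ∸ j) (λ k → s j ℤ.* t (j + k ∸ j) ℤ.* u (n ∸ (j + k))))
    ≡⟨ sumTo-cong n (λ j _ → sumTo-cong (n ∸ j) (λ k _ → reindex n j k)) ⟩
  sumTo n (λ j → sumTo (n ∸ j) (λ k → s j ℤ.* (t k ℤ.* u (n ∸ j ∸ k))))
    ≡⟨ sumTo-cong n (λ j _ → sumTo-*ˡ (n ∸ j) (s j) _) ⟩
  sumTo n (λ j → s j ℤ.* sumTo (n ∸ j) (λ k → t k ℤ.* u (n ∸ j ∸ k))) ∎
  where
  open ≡-Reasoning
  reindex : ∀ n j k → s j ℤ.* t (j + k ∸ j) ℤ.* u (n ∸ (j + k)) ≡ s j ℤ.* (t k ℤ.* u (n ∸ j ∸ k))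
  reindex n j k rewrite ℕP.m+n∸m≡n j k | ℕP.∸-+-assoc n j k = ℤP.*-assoc (s j) (t k) _

⊛-distribˡ : ∀ s t u → s ⊛ (t ⊕ u) ≈ s ⊛ t ⊕ s ⊛ u
⊛-distribˡ s t u = mk≈ λ n →
  trans (sumTo-cong n (λ i _ → ℤP.*-distribˡ-+ (s i) (t (n ∸ i)) (u (n ∸ i)))) (sumTo-+ n _ _)

⊛-distribʳ : ∀ s t u → (t ⊕ u) ⊛ s ≈ t ⊛ s ⊕ u ⊛ s
⊛-distribʳ s t u =
  ≈-trans (⊛-comm (t ⊕ u) s) (≈-trans (⊛-distribˡ s t u) (⊕-cong (⊛-comm s t) (⊛-comm s u)))

⊛-identityˡ : ∀ s → one ⊛ s ≈ s
⊛-identityˡ s = mk≈ pointwise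
  where
  open ≡-Reasoning
  pointwise : ∀ n → (one ⊛ s) n ≡ s n
  pointwise zero    = ℤP.*-identityˡ (s 0)
  pointwise (suc n) = begin
    (one ⊛ s) (suc n)                         ≡⟨ sumTo-suc n _ ⟩
    + 1 ℤ.* s (suc n) ℤ.+ sumTo n (λ _ → + 0) ≡⟨ cong₂ ℤ._+_ (ℤP.*-identityˡ (s (suc n))) (sumTo-zero n (λ _ _ → refl)) ⟩
    s (suc n) ℤ.+ + 0                         ≡⟨ ℤP.+-identityʳ _ ⟩
    s (suc n)                                 ∎

⊛-identityʳ : ∀ s → s ⊛ one ≈ s
⊛-identityʳ s = ≈-trans (⊛-comm s one) (⊛-identityˡ s)

series-isCommutativeRing : IsCommutativeRing _≈_ _⊕_ _⊛_ ⊝_ zeroˢ one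
series-isCommutativeRing = record
  { isRing = record
    { +-isAbelianGroup = record
      { isGroup = record
        { isMonoid = record
          { isSemigroup = record
            { isMagma = record
              { isEquivalence = record { refl = ≈-refl ; sym = ≈-sym ; trans = ≈-trans }
              ; ∙-cong = ⊕-cong }
            ; assoc = λ s t u → mk≈ λ n → ℤP.+-assoc (s n) (t n) (u n) }
          ; identity = (λ s → mk≈ λ n → ℤP.+-identityˡ (s n)) , (λ s → mk≈ λ n → ℤP.+-identityʳ (s n)) }
        ; inverse = (λ s → mk≈ λ n → ℤP.+-inverseˡ (s n)) , (λ s → mk≈ λ n → ℤP.+-inverseʳ (s n))
        ; ⁻¹-cong = ⊝-cong }
      ; comm = λ s t → mk≈ λ n → ℤP.+-comm (s n) (t n) }
    ; *-cong = ⊛-cong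
    ; *-assoc = ⊛-assoc
    ; *-identity = ⊛-identityˡ , ⊛-identityʳ
    ; distrib = ⊛-distribˡ , ⊛-distribʳ }
  ; *-comm = ⊛-comm }

seriesRing : CommutativeRing _ _
seriesRing = record { isCommutativeRing = series-isCommutativeRing }

open CommutativeRing seriesRing public using ()
  renaming (zeroʳ to ⊛-zeroʳ; +-identityˡ to ⊕-identityˡ; +-identityʳ to ⊕-identityʳ)

module ≈-Reasoning = SetoidReasoning (CommutativeRing.setoid seriesRing)

⊛-vanishing : ∀ {s} x y → s ≈ zeroˢ → x ⊛ s ≈ y ⊛ zeroˢ
⊛-vanishing x y s≈0 = ≈-trans (⊛-cong (≈-refl {x}) s≈0) (≈-trans (⊛-zeroʳ x) (≈-sym (⊛-zeroʳ y)))

κ-scale : ∀ c s n → (κ c ⊛ s) n ≡ c ℤ.* s n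
κ-scale c s zero    = refl
κ-scale c s (suc n) = begin
  (κ c ⊛ s) (suc n)                          ≡⟨ sumTo-suc n _ ⟩
  c ℤ.* s (suc n) ℤ.+ sumTo n (λ _ → + 0)     ≡⟨ cong (ℤ._+_ (c ℤ.* s (suc n))) (sumTo-zero n (λ _ _ → refl)) ⟩
  c ℤ.* s (suc n) ℤ.+ + 0                    ≡⟨ ℤP.+-identityʳ _ ⟩
  c ℤ.* s (suc n)                            ∎
  where open ≡-Reasoning

κ1≈one : κ (+ 1) ≈ one
κ1≈one = mk≈ λ where
  zero    → refl
  (suc n) → refl

κ-homomorphism : ACR._-Raw-AlmostCommutative⟶_ (CommutativeRing.rawRing ℤP.+-*-commutativeRing)
                                              (ACR.fromCommutativeRing seriesRing)
κ-homomorphism = record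
  { ⟦_⟧    = κ
  ; +-homo = λ a b → mk≈ λ { zero → refl ; (suc n) → refl }
  ; *-homo = λ a b → mk≈ λ n → sym (trans (κ-scale a (κ b) n) (κ-times a b n))
  ; -‿homo = λ a → mk≈ λ { zero → refl ; (suc n) → refl }
  ; 0-homo = mk≈ λ { zero → refl ; (suc n) → refl }
  ; 1-homo = κ1≈one }
  where
  κ-times : ∀ a b n → a ℤ.* κ b n ≡ κ (a ℤ.* b) n
  κ-times a b zero    = refl
  κ-times a b (suc n) = ℤP.*-zeroʳ a

κ-equal? : ∀ a b → Maybe (κ a ≈ κ b)
κ-equal? a b with a ℤ.≟ b
... | yes refl = just ≈-refl
... | no _     = nothing

-- Coefficients are normalised in ℤ and embedded by κ, so identities such as 2 · 2 = 4 are decided;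
-- the reflective solver over Series itself could not compare such coefficients.
module SeriesSolver = Algebra.Solver.Ring (CommutativeRing.rawRing ℤP.+-*-commutativeRing)
  (ACR.fromCommutativeRing seriesRing) κ-homomorphism κ-equal?

q^_ : ℕ → Series
(q^ k) n with n ℕ.≟ k
... | yes _ = + 1
... | no _  = + 0

q^k-at-k : ∀ k → (q^ k) k ≡ + 1
q^k-at-k k with k ℕ.≟ k
... | yes _  = refl
... | no k≢k = ⊥-elim (k≢k refl)

q^k-at-n≢k : ∀ k n → n ≢ k → (q^ k) n ≡ + 0
q^k-at-n≢k k n n≢k with n ℕ.≟ k
... | yes n≡k = ⊥-elim (n≢k n≡k)
... | no _    = refl

q^-shift : ∀ a s n → a ≤ n → (q^ a ⊛ s) n ≡ s (n ∸ a)
q^-shift a s n a≤n = begin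
  (q^ a ⊛ s) n            ≡⟨ sumTo-single n a other a≤n ⟩
  (q^ a) a ℤ.* s (n ∸ a)   ≡⟨ cong (ℤ._* s (n ∸ a)) (q^k-at-k a) ⟩
  + 1 ℤ.* s (n ∸ a)        ≡⟨ ℤP.*-identityˡ _ ⟩
  s (n ∸ a)               ∎
  where
  open ≡-Reasoning
  other : ∀ i → i ≢ a → (q^ a) i ℤ.* s (n ∸ i) ≡ + 0
  other i i≢a rewrite q^k-at-n≢k a i i≢a = refl

q^-shift-below : ∀ a s n → n < a → (q^ a ⊛ s) n ≡ + 0
q^-shift-below a s n n<a = sumTo-zero n λ i i≤n →
  cong (ℤ._* s (n ∸ i)) (q^k-at-n≢k a i (ℕP.<⇒≢ (ℕP.≤-<-trans i≤n n<a)))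

q^-+ : ∀ a b {c} → a + b ≡ c → q^ a ⊛ q^ b ≈ q^ c
q^-+ a b refl = mk≈ pointwise
  where
  pointwise : ∀ n → (q^ a ⊛ q^ b) n ≡ (q^ (a + b)) n
  pointwise n with a ℕ.≤? n
  ... | yes a≤n = trans (q^-shift a (q^ b) n a≤n) (compare (n ℕ.≟ a + b))
    where
    compare : Dec (n ≡ a + b) → (q^ b) (n ∸ a) ≡ (q^ (a + b)) n
    compare (yes refl) = trans (cong (q^ b) (ℕP.m+n∸m≡n a b)) (trans (q^k-at-k b) (sym (q^k-at-k (a + b))))
    compare (no n≢a+b) = trans (q^k-at-n≢k b (n ∸ a) λ n∸a≡b →
                                  n≢a+b (trans (sym (ℕP.m+[n∸m]≡n a≤n)) (cong (_+_ a) n∸a≡b)))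
                               (sym (q^k-at-n≢k (a + b) n n≢a+b))
  ... | no a≰n = trans (q^-shift-below a (q^ b) n (ℕP.≰⇒> a≰n))
      (sym (q^k-at-n≢k (a + b) n λ n≡a+b → a≰n (subst (a ≤_) (sym n≡a+b) (ℕP.m≤m+n a b))))

q^-double : ∀ k → q^ (2 * k) ≈ q^ k ⊛ q^ k
q^-double k = ≈-sym (q^-+ k k (cong (_+_ k) (sym (ℕP.+-identityʳ k))))

q^-≡ : ∀ k k′ → k ≡ k′ → q^ k ≈ q^ k′
q^-≡ k .k refl = ≈-refl

q^-shift-factor : ∀ {s} c x y z H → s ≈ q^ x ⊛ H → c + x ≡ y + z → q^ c ⊛ s ≈ q^ y ⊛ (q^ z ⊛ H)
q^-shift-factor {s} c x y z H s≈ eq = begin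
  q^ c ⊛ s           ≈⟨ ⊛-cong (≈-refl {q^ c}) s≈ ⟩
  q^ c ⊛ (q^ x ⊛ H)  ≈⟨ ⊛-assoc (q^ c) (q^ x) H ⟨
  (q^ c ⊛ q^ x) ⊛ H  ≈⟨ ⊛-cong (≈-trans (q^-+ c x eq) (≈-sym (q^-+ y z refl))) (≈-refl {H}) ⟩
  (q^ y ⊛ q^ z) ⊛ H  ≈⟨ ⊛-assoc (q^ y) (q^ z) H ⟩
  q^ y ⊛ (q^ z ⊛ H)  ∎
  where open ≈-Reasoning

q^0≈one : q^ 0 ≈ one
q^0≈one = mk≈ λ { zero → refl ; (suc n) → refl }

oneMinusQ-expand : ∀ a .{{_ : ℕ.NonZero a}} → oneMinusQ a ≈ κ (+ 1) ⊕ ⊝ q^ a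
oneMinusQ-expand (suc a) = mk≈ pointwise
  where
  pointwise : ∀ n → oneMinusQ (suc a) n ≡ (κ (+ 1) ⊕ ⊝ q^ suc a) n
  pointwise zero = refl
  pointwise (suc n) with suc n ℕ.≟ suc a
  ... | yes _ = refl
  ... | no _  = refl

oneMinusQ⊕q^ : ∀ a .{{_ : ℕ.NonZero a}} → oneMinusQ a ⊕ q^ a ≈ one
oneMinusQ⊕q^ a = ≈-trans (⊕-cong (oneMinusQ-expand a) (≈-refl {q^ a})) (≈-trans (cancel (q^ a)) κ1≈one)
  where
  cancel : ∀ s → κ (+ 1) ⊕ ⊝ s ⊕ s ≈ κ (+ 1)
  cancel = solve 1 (λ s → con (+ 1) :- s :+ s := con (+ 1)) ≈-refl
    where open SeriesSolver

-- Truncation and infinite products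

-- s ≈[ K ] t  says  s ≡ t (mod q^K).
infix 4 _≈[_]_
record _≈[_]_ (s : Series) (K : ℕ) (t : Series) : Set where
  constructor mk≈[]
  field below : ∀ n → n < K → s n ≡ t n
open _≈[_]_ public

≈⇒≈[] : ∀ {s t K} → s ≈ t → s ≈[ K ] t
≈⇒≈[] s≈t = mk≈[] λ n _ → at s≈t n

≈[]-weaken : ∀ {s t K L} → L ≤ K → s ≈[ K ] t → s ≈[ L ] t
≈[]-weaken L≤K s≈t = mk≈[] λ n n<L → below s≈t n (ℕP.<-≤-trans n<L L≤K)

≈[]-refl : ∀ {s K} → s ≈[ K ] s
≈[]-refl = mk≈[] λ _ _ → refl

≈[]-sym : ∀ {s t K} → s ≈[ K ] t → t ≈[ K ] s
≈[]-sym s≈t = mk≈[] λ n n<K → sym (below s≈t n n<K)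

≈[]-trans : ∀ {s t u K} → s ≈[ K ] t → t ≈[ K ] u → s ≈[ K ] u
≈[]-trans s≈t t≈u = mk≈[] λ n n<K → trans (below s≈t n n<K) (below t≈u n n<K)

⊕-cong[] : ∀ {s s′ t t′ K} → s ≈[ K ] s′ → t ≈[ K ] t′ → s ⊕ t ≈[ K ] s′ ⊕ t′
⊕-cong[] s≈s′ t≈t′ = mk≈[] λ n n<K → cong₂ ℤ._+_ (below s≈s′ n n<K) (below t≈t′ n n<K)

⊝-cong[] : ∀ {s s′ K} → s ≈[ K ] s′ → ⊝ s ≈[ K ] ⊝ s′
⊝-cong[] s≈s′ = mk≈[] λ n n<K → cong ℤ.-_ (below s≈s′ n n<K)

⊛-cong[] : ∀ {s s′ t t′ K} → s ≈[ K ] s′ → t ≈[ K ] t′ → s ⊛ t ≈[ K ] s′ ⊛ t′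
⊛-cong[] s≈s′ t≈t′ = mk≈[] λ n n<K → sumTo-cong n λ i i≤n →
  cong₂ ℤ._*_ (below s≈s′ i (ℕP.≤-<-trans i≤n n<K)) (below t≈t′ (n ∸ i) (ℕP.≤-<-trans (ℕP.m∸n≤m n i) n<K))

≈[]-setoid : ℕ → Setoid _ _
≈[]-setoid K = record
  { Carrier       = Series
  ; _≈_           = λ s t → s ≈[ K ] t
  ; isEquivalence = record { refl = ≈[]-refl ; sym = ≈[]-sym ; trans = ≈[]-trans } }

module ≈[]-Reasoning {K} = SetoidReasoning (≈[]-setoid K)

q^-shift-cong[] : ∀ a {s t K} → s ≈[ K ] t → q^ a ⊛ s ≈[ a + K ] q^ a ⊛ t
q^-shift-cong[] a {s} {t} {K} s≈t = mk≈[] pointwise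
  where
  pointwise : ∀ n → n < a + K → (q^ a ⊛ s) n ≡ (q^ a ⊛ t) n
  pointwise n n<a+K with a ℕ.≤? n
  ... | yes a≤n = trans (q^-shift a s n a≤n) (trans (below s≈t (n ∸ a) n∸a<K) (sym (q^-shift a t n a≤n)))
    where
    n∸a<K : n ∸ a < K
    n∸a<K = ℕP.+-cancelˡ-< a _ _ (subst (_< a + K) (sym (ℕP.m+[n∸m]≡n a≤n)) n<a+K)
  ... | no a≰n = trans (q^-shift-below a s n (ℕP.≰⇒> a≰n)) (sym (q^-shift-below a t n (ℕP.≰⇒> a≰n)))

q^≈[]zero : ∀ a → q^ a ≈[ a ] zeroˢ
q^≈[]zero a = mk≈[] λ n n<a → q^k-at-n≢k a n (ℕP.<⇒≢ n<a)

-- The limit of a sequence of series s₀, s₁, … that stabilises: s (d + N) ≡ s N (mod q^{B N}).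
diagonal : (ℕ → Series) → Series
diagonal s n = s n n

diagonal-truncate : ∀ (s : ℕ → Series) (B : ℕ → ℕ) → (∀ N → N < B N) →
  (∀ N d → s (d + N) ≈[ B N ] s N) → ∀ N → diagonal s ≈[ B N ] s N
diagonal-truncate s B N<B stable N = mk≈[] pointwise
  where
  pointwise : ∀ n → n < B N → s n n ≡ s N n
  pointwise n n<B with ℕP.≤-total n N
  ... | inj₁ n≤N = sym (subst (λ M → s M n ≡ s n n) (ℕP.m∸n+n≡m n≤N) (below (stable n (N ∸ n)) n (N<B n)))
  ... | inj₂ N≤n = subst (λ M → s M n ≡ s N n) (ℕP.m∸n+n≡m N≤n) (below (stable N (n ∸ N)) n n<B)

∏∞ : (ℕ → Series) → Series
∏∞ F = diagonal (λ N → prodTo N F)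

prodTo-stable : ∀ h (F : ℕ → Series) → (∀ k → F k ≈[ h * k ] one) →
  ∀ N d → prodTo (d + N) F ≈[ h * suc N ] prodTo N F
prodTo-stable h F F≈one N zero    = ≈[]-refl
prodTo-stable h F F≈one N (suc d) = ≈[]-trans lastFactor (prodTo-stable h F F≈one N d)
  where
  lastFactor : prodTo (d + N) F ⊛ F (suc (d + N)) ≈[ h * suc N ] prodTo (d + N) F
  lastFactor = ≈[]-trans
    (⊛-cong[] (≈[]-refl {prodTo (d + N) F}) (≈[]-weaken (ℕP.*-monoʳ-≤ h (s≤s (ℕP.m≤n+m N d))) (F≈one (suc (d + N)))))
    (≈⇒≈[] (⊛-identityʳ _))

∏∞-truncate : ∀ h .{{_ : ℕ.NonZero h}} (F : ℕ → Series) → (∀ k → F k ≈[ h * k ] one) →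
  ∀ N → ∏∞ F ≈[ h * suc N ] prodTo N F
∏∞-truncate h F F≈one = diagonal-truncate (λ N → prodTo N F) (λ N → h * suc N)
  (λ N → ℕP.<-≤-trans (ℕP.n<1+n N) (ℕP.m≤n*m (suc N) h)) (prodTo-stable h F F≈one)

prodTo-cong : ∀ N {F G : ℕ → Series} → (∀ k → F (suc k) ≈ G (suc k)) → prodTo N F ≈ prodTo N G
prodTo-cong zero    F≈G = ≈-refl
prodTo-cong (suc N) F≈G = ⊛-cong (prodTo-cong N F≈G) (F≈G N)

prodTo-⊛ : ∀ N (F G : ℕ → Series) → prodTo N F ⊛ prodTo N G ≈ prodTo N (λ k → F k ⊛ G k)
prodTo-⊛ zero    F G = ⊛-identityˡ one
prodTo-⊛ (suc N) F G =
  ≈-trans (interchange (prodTo N F) (F (suc N)) (prodTo N G) (G (suc N)))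
          (⊛-cong (prodTo-⊛ N F G) (≈-refl {F (suc N) ⊛ G (suc N)}))
  where
  interchange : ∀ a b c d → (a ⊛ b) ⊛ (c ⊛ d) ≈ (a ⊛ c) ⊛ (b ⊛ d)
  interchange = solve 4 (λ a b c d → (a :* b) :* (c :* d) := (a :* c) :* (b :* d)) ≈-refl
    where open SeriesSolver

prodTo-one : ∀ N → prodTo N (λ _ → one) ≈ one
prodTo-one zero    = ≈-refl
prodTo-one (suc N) = ≈-trans (⊛-identityʳ _) (prodTo-one N)

∏∞-⊛ : ∀ h .{{_ : ℕ.NonZero h}} (F G : ℕ → Series) →
  (∀ k → F k ≈[ h * k ] one) → (∀ k → G k ≈[ h * k ] one) → ∏∞ F ⊛ ∏∞ G ≈ ∏∞ (λ k → F k ⊛ G k)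
∏∞-⊛ h F G F≈one G≈one = mk≈ λ n →
  trans (below (⊛-cong[] (∏∞-truncate h F F≈one n) (∏∞-truncate h G G≈one n)) n (n<h[1+n] n))
        (at (prodTo-⊛ n F G) n)
  where
  n<h[1+n] : ∀ n → n < h * suc n
  n<h[1+n] n = ℕP.<-≤-trans (ℕP.n<1+n n) (ℕP.m≤n*m (suc n) h)

∏∞-cong : ∀ {F G : ℕ → Series} → (∀ k → F (suc k) ≈ G (suc k)) → ∏∞ F ≈ ∏∞ G
∏∞-cong F≈G = mk≈ λ n → at (prodTo-cong n F≈G) n

∏∞-one : ∏∞ (λ _ → one) ≈ one
∏∞-one = mk≈ λ n → at (prodTo-one n) n

oneMinusQ≈[]one : ∀ a → oneMinusQ a ≈[ a ] one
oneMinusQ≈[]one a = mk≈[] pointwise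
  where
  pointwise : ∀ n → n < a → oneMinusQ a n ≡ one n
  pointwise zero    _ = refl
  pointwise (suc n) n<a with suc n ℕ.≟ a
  ... | yes 1+n≡a = ⊥-elim (ℕP.<⇒≢ n<a 1+n≡a)
  ... | no _      = refl

geom-at-multiple : ∀ a n → a ∣ n → geom a n ≡ + 1
geom-at-multiple a n a∣n with a ∣? n
... | yes _  = refl
... | no a∤n = ⊥-elim (a∤n a∣n)

geom-at-non-multiple : ∀ a n → ¬ (a ∣ n) → geom a n ≡ + 0
geom-at-non-multiple a n a∤n with a ∣? n
... | yes a∣n = ⊥-elim (a∤n a∣n)
... | no _    = refl

geom≈[]one : ∀ a → geom a ≈[ a ] one
geom≈[]one a = mk≈[] pointwise
  where
  pointwise : ∀ n → n < a → geom a n ≡ one n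
  pointwise zero    _   = geom-at-multiple a 0 (a ND.∣0)
  pointwise (suc n) n<a = geom-at-non-multiple a (suc n) (λ a∣n → ℕP.<⇒≱ n<a (ND.∣⇒≤ a∣n))

-- (1 - q^a) Σ_j q^{aj} telescopes: the coefficients of q^n and q^{n-a} in the geometric series agree.
oneMinusQ⊛geom : ∀ a .{{_ : ℕ.NonZero a}} → oneMinusQ a ⊛ geom a ≈ one
oneMinusQ⊛geom a = ≈-trans (⊛-cong (oneMinusQ-expand a) (≈-refl {geom a})) (≈-trans (expand (q^ a) (geom a)) (mk≈ telescope))
  where
  expand : ∀ m g → (κ (+ 1) ⊕ ⊝ m) ⊛ g ≈ g ⊕ ⊝ (m ⊛ g)
  expand = solve 2 (λ m g → (con (+ 1) :- m) :* g := g :- m :* g) ≈-refl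
    where open SeriesSolver
  telescope : ∀ n → geom a n ℤ.+ ℤ.- (q^ a ⊛ geom a) n ≡ one n
  telescope n with a ℕ.≤? n
  ... | no a≰n rewrite q^-shift-below a (geom a) n (ℕP.≰⇒> a≰n) =
        trans (ℤP.+-identityʳ _) (below (geom≈[]one a) n (ℕP.≰⇒> a≰n))
  ... | yes a≤n rewrite q^-shift a (geom a) n a≤n = trans (cancel (a ∣? n)) (sym (one-vanishes n a≤n))
    where
    one-vanishes : ∀ n → a ≤ n → one n ≡ + 0
    one-vanishes zero    a≤0 = ⊥-elim (ℕP.<⇒≱ (ℕ.>-nonZero⁻¹ a) a≤0)
    one-vanishes (suc n) _   = refl
    n≡a+[n∸a] : n ≡ a + (n ∸ a)
    n≡a+[n∸a] = sym (ℕP.m+[n∸m]≡n a≤n)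
    multiple : a ∣ n → a ∣ n ∸ a
    multiple a∣n = ND.∣m+n∣m⇒∣n (subst (a ∣_) n≡a+[n∸a] a∣n) ND.∣-refl
    non-multiple : ¬ (a ∣ n) → ¬ (a ∣ n ∸ a)
    non-multiple a∤n a∣n∸a = a∤n (subst (a ∣_) (sym n≡a+[n∸a]) (ND.∣m∣n⇒∣m+n ND.∣-refl a∣n∸a))
    cancel : Dec (a ∣ n) → geom a n ℤ.+ ℤ.- geom a (n ∸ a) ≡ + 0
    cancel (yes a∣n) rewrite geom-at-multiple a n a∣n
                           | geom-at-multiple a (n ∸ a) (multiple a∣n) = refl
    cancel (no a∤n)  rewrite geom-at-non-multiple a n a∤n
                           | geom-at-non-multiple a (n ∸ a) (non-multiple a∤n) = refl

f⊛finv : ∀ h .{{_ : ℕ.NonZero h}} → f h ⊛ finv h ≈ one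
f⊛finv h = begin
  f h ⊛ finv h
    ≈⟨ ∏∞-⊛ h _ _ (λ k → oneMinusQ≈[]one (h * k)) (λ k → geom≈[]one (h * k)) ⟩
  ∏∞ (λ k → oneMinusQ (h * k) ⊛ geom (h * k))
    ≈⟨ ∏∞-cong (λ k → oneMinusQ⊛geom (h * suc k) {{ℕP.m*n≢0 h (suc k)}}) ⟩
  ∏∞ (λ _ → one)
    ≈⟨ ∏∞-one ⟩
  one ∎
  where open ≈-Reasoning

f⊛f : ∀ h .{{_ : ℕ.NonZero h}} → f h ⊛ f h ≈ ∏∞ (λ k → oneMinusQ (h * k) ⊛ oneMinusQ (h * k))
f⊛f h = ∏∞-⊛ h _ _ (λ k → oneMinusQ≈[]one (h * k)) (λ k → oneMinusQ≈[]one (h * k))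

f≈[]prodTo : ∀ h .{{_ : ℕ.NonZero h}} N → f h ≈[ h * suc N ] prodTo N (λ k → oneMinusQ (h * k))
f≈[]prodTo h = ∏∞-truncate h _ (λ k → oneMinusQ≈[]one (h * k))

-- Gaussian binomial coefficients

-- qbinom a b is the Gaussian binomial coefficient [a+b choose a] in the base q².
qbinom : ℕ → ℕ → Series
qbinom zero    b       = one
qbinom (suc a) zero    = one
qbinom (suc a) (suc b) = qbinom a (suc b) ⊕ q^ (2 * suc a) ⊛ qbinom (suc a) b

qbinom-≡ : ∀ a b b′ → b ≡ b′ → qbinom a b ≈ qbinom a b′
qbinom-≡ a b .b refl = ≈-refl

qbinom₁-pascal : ∀ b → qbinom 1 (suc b) ≈ qbinom 1 b ⊕ q^ (2 * suc b) ⊛ one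
qbinom₁-pascal zero    = ≈-refl
qbinom₁-pascal (suc b) = begin
  one ⊕ q^ 2 ⊛ qbinom 1 (suc b)                      ≈⟨ ⊕-cong (≈-refl {one}) (⊛-cong (≈-refl {q^ 2}) (qbinom₁-pascal b)) ⟩
  one ⊕ q^ 2 ⊛ (qbinom 1 b ⊕ q^ (2 * suc b) ⊛ one)   ≈⟨ regroup one (q^ 2) (qbinom 1 b) (q^ (2 * suc b)) ⟩
  (one ⊕ q^ 2 ⊛ qbinom 1 b) ⊕ (q^ 2 ⊛ q^ (2 * suc b)) ⊛ one
    ≈⟨ ⊕-cong (≈-refl {one ⊕ q^ 2 ⊛ qbinom 1 b}) (⊛-cong (q^-+ 2 (2 * suc b) (ℕ-Solver.solve (b ∷ []))) (≈-refl {one})) ⟩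
  (one ⊕ q^ 2 ⊛ qbinom 1 b) ⊕ q^ (2 * suc (suc b)) ⊛ one ∎
  where
  open ≈-Reasoning
  regroup : ∀ I m g p → I ⊕ m ⊛ (g ⊕ p ⊛ I) ≈ (I ⊕ m ⊛ g) ⊕ (m ⊛ p) ⊛ I
  regroup = solve 4 (λ I m g p → I :+ m :* (g :+ p :* I) := (I :+ m :* g) :+ (m :* p) :* I) ≈-refl
    where open SeriesSolver

qbinom-pascal₁ : ∀ a → qbinom (suc a) 1 ≈ one ⊕ q^ 2 ⊛ qbinom a 1
qbinom-pascal₁ zero    = ≈-refl
qbinom-pascal₁ (suc a) = begin
  qbinom (suc a) 1 ⊕ q^ (2 * suc (suc a)) ⊛ one
    ≈⟨ ⊕-cong (qbinom-pascal₁ a) (≈-refl {q^ (2 * suc (suc a)) ⊛ one}) ⟩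
  (one ⊕ q^ 2 ⊛ qbinom a 1) ⊕ q^ (2 * suc (suc a)) ⊛ one
    ≈⟨ ⊕-cong (≈-refl {one ⊕ q^ 2 ⊛ qbinom a 1}) (⊛-cong (q^-+ 2 (2 * suc a) (ℕ-Solver.solve (a ∷ []))) (≈-refl {one})) ⟨
  (one ⊕ q^ 2 ⊛ qbinom a 1) ⊕ (q^ 2 ⊛ q^ (2 * suc a)) ⊛ one
    ≈⟨ regroup one (q^ 2) (qbinom a 1) (q^ (2 * suc a)) ⟨
  one ⊕ q^ 2 ⊛ (qbinom a 1 ⊕ q^ (2 * suc a) ⊛ one) ∎
  where
  open ≈-Reasoning
  regroup : ∀ I m g p → I ⊕ m ⊛ (g ⊕ p ⊛ I) ≈ (I ⊕ m ⊛ g) ⊕ (m ⊛ p) ⊛ I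
  regroup = solve 4 (λ I m g p → I :+ m :* (g :+ p :* I) := (I :+ m :* g) :+ (m :* p) :* I) ≈-refl
    where open SeriesSolver

qbinom-pascal : ∀ a b → qbinom (suc a) (suc b) ≈ qbinom (suc a) b ⊕ q^ (2 * suc b) ⊛ qbinom a (suc b)
qbinom-pascal zero    b    = qbinom₁-pascal b
qbinom-pascal (suc a) zero = qbinom-pascal₁ (suc a)
qbinom-pascal (suc a) (suc b) = begin
  qbinom (suc a) (suc (suc b)) ⊕ p ⊛ qbinom (suc (suc a)) (suc b)
    ≈⟨ ⊕-cong (qbinom-pascal a (suc b)) (⊛-cong (≈-refl {p}) (qbinom-pascal (suc a) b)) ⟩
  (A ⊕ r ⊛ B) ⊕ p ⊛ (C ⊕ q ⊛ A)         ≈⟨ regroup A B C p q r ⟩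
  (A ⊕ p ⊛ C ⊕ r ⊛ B) ⊕ (p ⊛ q) ⊛ A     ≈⟨ ⊕-cong (≈-refl {A ⊕ p ⊛ C ⊕ r ⊛ B}) (⊛-cong pq≈rs (≈-refl {A})) ⟩
  (A ⊕ p ⊛ C ⊕ r ⊛ B) ⊕ (r ⊛ s) ⊛ A     ≈⟨ regroup′ A B C p r s ⟨
  (A ⊕ p ⊛ C) ⊕ r ⊛ (B ⊕ s ⊛ A)         ∎
  where
  open ≈-Reasoning
  p = q^ (2 * suc (suc a))
  q = q^ (2 * suc b)
  r = q^ (2 * suc (suc b))
  s = q^ (2 * suc a)
  A = qbinom (suc a) (suc b)
  B = qbinom a (suc (suc b))
  C = qbinom (suc (suc a)) b
  pq≈rs : p ⊛ q ≈ r ⊛ s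
  pq≈rs = ≈-trans (q^-+ _ _ refl) (≈-sym (q^-+ _ _ (ℕ-Solver.solve (a ∷ b ∷ []))))
  regroup : ∀ A B C p q r → (A ⊕ r ⊛ B) ⊕ p ⊛ (C ⊕ q ⊛ A) ≈ (A ⊕ p ⊛ C ⊕ r ⊛ B) ⊕ (p ⊛ q) ⊛ A
  regroup = solve 6 (λ A B C p q r → (A :+ r :* B) :+ p :* (C :+ q :* A) := (A :+ p :* C :+ r :* B) :+ (p :* q) :* A) ≈-refl
    where open SeriesSolver
  regroup′ : ∀ A B C p r s → (A ⊕ p ⊛ C) ⊕ r ⊛ (B ⊕ s ⊛ A) ≈ (A ⊕ p ⊛ C ⊕ r ⊛ B) ⊕ (r ⊛ s) ⊛ A
  regroup′ = solve 6 (λ A B C p r s → (A :+ p :* C) :+ r :* (B :+ s :* A) := (A :+ p :* C :+ r :* B) :+ (r :* s) :* A) ≈-refl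
    where open SeriesSolver

qbinom-sym : ∀ a b → qbinom a b ≈ qbinom b a
qbinom-sym zero    zero    = ≈-refl
qbinom-sym zero    (suc b) = ≈-refl
qbinom-sym (suc a) zero    = ≈-refl
qbinom-sym (suc a) (suc b) = ≈-sym (≈-trans (qbinom-pascal b a)
  (⊕-cong (qbinom-sym (suc b) a) (⊛-cong (≈-refl {q^ (2 * suc a)}) (qbinom-sym b (suc a)))))

qbinom-recurrence₃ : ∀ a b →
  qbinom (suc (suc a)) (suc (suc b)) ≈
    qbinom (suc a) (suc b) ⊕ q^ (2 * suc (suc (suc (a + b)))) ⊛ qbinom (suc a) (suc b)
    ⊕ q^ (2 * suc (suc b)) ⊛ qbinom a (suc (suc b)) ⊕ q^ (2 * suc (suc a)) ⊛ qbinom (suc (suc a)) b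
qbinom-recurrence₃ a b = begin
  qbinom (suc a) (suc (suc b)) ⊕ p ⊛ qbinom (suc (suc a)) (suc b)
    ≈⟨ ⊕-cong (qbinom-pascal a (suc b)) (⊛-cong (≈-refl {p}) (qbinom-pascal (suc a) b)) ⟩
  (A ⊕ r ⊛ B) ⊕ p ⊛ (C ⊕ q ⊛ A)          ≈⟨ regroup A B C p q r ⟩
  A ⊕ (p ⊛ q) ⊛ A ⊕ r ⊛ B ⊕ p ⊛ C
    ≈⟨ ⊕-cong (⊕-cong (⊕-cong (≈-refl {A}) (⊛-cong (q^-+ _ _ (ℕ-Solver.solve (a ∷ b ∷ []))) (≈-refl {A})))
                      (≈-refl {r ⊛ B})) (≈-refl {p ⊛ C}) ⟩
  A ⊕ q^ (2 * suc (suc (suc (a + b)))) ⊛ A ⊕ r ⊛ B ⊕ p ⊛ C ∎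
  where
  open ≈-Reasoning
  p = q^ (2 * suc (suc a))
  q = q^ (2 * suc b)
  r = q^ (2 * suc (suc b))
  A = qbinom (suc a) (suc b)
  B = qbinom a (suc (suc b))
  C = qbinom (suc (suc a)) b
  regroup : ∀ A B C p q r → (A ⊕ r ⊛ B) ⊕ p ⊛ (C ⊕ q ⊛ A) ≈ A ⊕ (p ⊛ q) ⊛ A ⊕ r ⊛ B ⊕ p ⊛ C
  regroup = solve 6 (λ A B C p q r → (A :+ r :* B) :+ p :* (C :+ q :* A) := A :+ (p :* q) :* A :+ r :* B :+ p :* C) ≈-refl
    where open SeriesSolver

qbinom-recurrence₃-edge : ∀ b →
  qbinom 1 (suc (suc b)) ≈ one ⊕ q^ (2 * suc (suc b)) ⊛ one ⊕ q^ 2 ⊛ qbinom 1 b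
qbinom-recurrence₃-edge b = begin
  one ⊕ q^ 2 ⊛ qbinom 1 (suc b)                         ≈⟨ ⊕-cong (≈-refl {one}) (⊛-cong (≈-refl {q^ 2}) (qbinom₁-pascal b)) ⟩
  one ⊕ q^ 2 ⊛ (qbinom 1 b ⊕ q^ (2 * suc b) ⊛ one)      ≈⟨ regroup one (q^ 2) (qbinom 1 b) (q^ (2 * suc b)) ⟩
  one ⊕ (q^ 2 ⊛ q^ (2 * suc b)) ⊛ one ⊕ q^ 2 ⊛ qbinom 1 b
    ≈⟨ ⊕-cong (⊕-cong (≈-refl {one}) (⊛-cong (q^-+ 2 (2 * suc b) (ℕ-Solver.solve (b ∷ []))) (≈-refl {one})))
              (≈-refl {q^ 2 ⊛ qbinom 1 b}) ⟩
  one ⊕ q^ (2 * suc (suc b)) ⊛ one ⊕ q^ 2 ⊛ qbinom 1 b ∎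
  where
  open ≈-Reasoning
  regroup : ∀ I m g p → I ⊕ m ⊛ (g ⊕ p ⊛ I) ≈ I ⊕ (m ⊛ p) ⊛ I ⊕ m ⊛ g
  regroup = solve 4 (λ I m g p → I :+ m :* (g :+ p :* I) := I :+ (m :* p) :* I :+ m :* g) ≈-refl
    where open SeriesSolver

-- The finite Jacobi triple product

-- For c j the coefficient of z^j (j ≥ 0) in a Laurent polynomial invariant under
-- z ↦ z⁻¹, previous c j is the coefficient of z^(j-1).
previous : (ℕ → Series) → ℕ → Series
previous c zero    = c 1
previous c (suc j) = c j

-- jacobiCoeff N j is the coefficient of z^j (and of z^-j) in ∏_{k=1}^N (1 + z q^{2k-1}) (1 + z⁻¹ q^{2k-1});
-- the recursion multiplies by (1 + z c) (1 + z⁻¹ c) = 1 + c² + c z + c z⁻¹ with c = q^{2N+1}.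
jacobiCoeff : ℕ → ℕ → Series
jacobiCoeff zero    zero    = one
jacobiCoeff zero    (suc j) = zeroˢ
jacobiCoeff (suc N) j =
  jacobiCoeff N j ⊕ q^ (2 * suc (2 * N)) ⊛ jacobiCoeff N j
  ⊕ q^ (suc (2 * N)) ⊛ jacobiCoeff N (suc j) ⊕ q^ (suc (2 * N)) ⊛ previous (jacobiCoeff N) j

jacobiCoeff-vanish : ∀ N j → N < j → jacobiCoeff N j ≈ zeroˢ
jacobiCoeff-vanish zero    (suc j) _         = ≈-refl
jacobiCoeff-vanish (suc N) (suc j) (s≤s N<j) = begin
  D (suc j) ⊕ m² ⊛ D (suc j) ⊕ m ⊛ D (suc (suc j)) ⊕ m ⊛ D j
    ≈⟨ ⊕-cong (⊕-cong (⊕-cong (vanish 1) (⊛-cong (≈-refl {m²}) (vanish 1))) (⊛-cong (≈-refl {m}) (vanish 2)))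
              (⊛-cong (≈-refl {m}) (vanish 0)) ⟩
  zeroˢ ⊕ m² ⊛ zeroˢ ⊕ m ⊛ zeroˢ ⊕ m ⊛ zeroˢ
    ≈⟨ mk≈ (λ n → cong₂ ℤ._+_ (cong₂ ℤ._+_ (cong (ℤ._+_ (+ 0)) (at (⊛-zeroʳ m²) n)) (at (⊛-zeroʳ m) n))
                              (at (⊛-zeroʳ m) n)) ⟩
  zeroˢ ∎
  where
  open ≈-Reasoning
  D = jacobiCoeff N
  m = q^ (suc (2 * N))
  m² = q^ (2 * suc (2 * N))
  vanish : ∀ i → D (i + j) ≈ zeroˢ
  vanish i = jacobiCoeff-vanish N (i + j) (ℕP.<-≤-trans N<j (ℕP.m≤n+m j i))

jacobiCoeff-suc : ∀ N j {J H₀ H₊ H₋ H} →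
  jacobiCoeff N j ≈ J ⊛ H₀ →
  q^ (suc (2 * N)) ⊛ jacobiCoeff N (suc j) ≈ J ⊛ H₊ →
  q^ (suc (2 * N)) ⊛ previous (jacobiCoeff N) j ≈ J ⊛ H₋ →
  H ≈ H₀ ⊕ q^ (2 * suc (2 * N)) ⊛ H₀ ⊕ H₊ ⊕ H₋ →
  jacobiCoeff (suc N) j ≈ J ⊛ H
jacobiCoeff-suc N j {J} {H₀} {H₊} {H₋} {H} e₀ e₊ e₋ eH = begin
  D j ⊕ m² ⊛ D j ⊕ m ⊛ D (suc j) ⊕ m ⊛ previous D j
    ≈⟨ ⊕-cong (⊕-cong (⊕-cong e₀ (⊛-cong (≈-refl {m²}) e₀)) e₊) e₋ ⟩
  J ⊛ H₀ ⊕ m² ⊛ (J ⊛ H₀) ⊕ J ⊛ H₊ ⊕ J ⊛ H₋  ≈⟨ factor J m² H₀ H₊ H₋ ⟩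
  J ⊛ (H₀ ⊕ m² ⊛ H₀ ⊕ H₊ ⊕ H₋)              ≈⟨ ⊛-cong (≈-refl {J}) eH ⟨
  J ⊛ H                                    ∎
  where
  open ≈-Reasoning
  D = jacobiCoeff N
  m = q^ (suc (2 * N))
  m² = q^ (2 * suc (2 * N))
  factor : ∀ J p a b c → J ⊛ a ⊕ p ⊛ (J ⊛ a) ⊕ J ⊛ b ⊕ J ⊛ c ≈ J ⊛ (a ⊕ p ⊛ a ⊕ b ⊕ c)
  factor = solve 5 (λ J p a b c → J :* a :+ p :* (J :* a) :+ J :* b :+ J :* c := J :* (a :+ p :* a :+ b :+ c)) ≈-refl
    where open SeriesSolver

-- jacobiCoeff N j = q^{j²} [2N choose N+j]_{q²}, written with a = N - j.
JacobiClosedForm : ℕ → Set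
JacobiClosedForm N = ∀ a j → a + j ≡ N → jacobiCoeff N j ≈ q^ (j * j) ⊛ qbinom a (a + 2 * j)

jacobiClosedForm-top : ∀ N → JacobiClosedForm N →
  jacobiCoeff (suc N) (suc N) ≈ q^ (suc N * suc N) ⊛ qbinom 0 (2 * suc N)
jacobiClosedForm-top N ih = jacobiCoeff-suc N (suc N) {J} {zeroˢ} {zeroˢ} {q^ 0 ⊛ one} {one}
  (≈-trans (jacobiCoeff-vanish N (suc N) ℕP.≤-refl) (≈-sym (⊛-zeroʳ J)))
  (⊛-vanishing (q^ (suc (2 * N))) J (jacobiCoeff-vanish N (suc (suc N)) (ℕP.m≤n⇒m≤1+n ℕP.≤-refl)))
  (q^-shift-factor (suc (2 * N)) (N * N) (suc N * suc N) 0 one (ih 0 N refl) (ℕ-Solver.solve (N ∷ [])))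
  (≈-sym only-last)
  where
  J = q^ (suc N * suc N)
  only-last : zeroˢ ⊕ q^ (2 * suc (2 * N)) ⊛ zeroˢ ⊕ zeroˢ ⊕ q^ 0 ⊛ one ≈ one
  only-last = mk≈ λ n →
    trans (cong₂ ℤ._+_ (trans (ℤP.+-identityʳ _) (trans (ℤP.+-identityˡ _) (at (⊛-zeroʳ (q^ (2 * suc (2 * N)))) n)))
                       (at (≈-trans (⊛-cong q^0≈one (≈-refl {one})) (⊛-identityˡ one)) n))
          (ℤP.+-identityˡ _)

jacobiClosedForm-centre : ∀ a → JacobiClosedForm (suc a + 0) →
  jacobiCoeff (suc (suc a + 0)) 0 ≈ q^ (0 * 0) ⊛ qbinom (suc (suc a)) (suc (suc a) + 2 * 0)
jacobiClosedForm-centre a ih =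
  jacobiCoeff-suc (suc a + 0) 0 {q^ 0} {G₀} {X} {X} {qbinom (suc (suc a)) (suc (suc a) + 2 * 0)}
    (ih (suc a) 0 refl) neighbour neighbour target
  where
  open ≈-Reasoning
  G₀ = qbinom (suc a) (suc a + 2 * 0)
  X = q^ (2 * suc (suc a)) ⊛ qbinom a (a + 2 * 1)
  G₁≈G₀ : qbinom (suc a) (suc a) ≈ G₀
  G₁≈G₀ = qbinom-≡ (suc a) (suc a) (suc a + 2 * 0) (ℕ-Solver.solve (a ∷ []))
  neighbour : q^ (suc (2 * (suc a + 0))) ⊛ jacobiCoeff (suc a + 0) 1 ≈ q^ 0 ⊛ X
  neighbour = q^-shift-factor (suc (2 * (suc a + 0))) 1 0 (2 * suc (suc a)) (qbinom a (a + 2 * 1))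
                              (ih a 1 (ℕP.+-suc a 0)) (ℕ-Solver.solve (a ∷ []))
  target : qbinom (suc (suc a)) (suc (suc a) + 2 * 0) ≈ G₀ ⊕ q^ (2 * suc (2 * (suc a + 0))) ⊛ G₀ ⊕ X ⊕ X
  target = begin
    qbinom (suc (suc a)) (suc (suc a) + 2 * 0)
      ≈⟨ qbinom-≡ (suc (suc a)) (suc (suc a) + 2 * 0) (suc (suc a)) (ℕ-Solver.solve (a ∷ [])) ⟩
    qbinom (suc (suc a)) (suc (suc a))
      ≈⟨ qbinom-recurrence₃ a a ⟩
    qbinom (suc a) (suc a) ⊕ q^ (2 * suc (suc (suc (a + a)))) ⊛ qbinom (suc a) (suc a)
    ⊕ q^ (2 * suc (suc a)) ⊛ qbinom a (suc (suc a)) ⊕ q^ (2 * suc (suc a)) ⊛ qbinom (suc (suc a)) a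
      ≈⟨ ⊕-cong (⊕-cong (⊕-cong G₁≈G₀ (⊛-cong (q^-≡ _ _ (ℕ-Solver.solve (a ∷ []))) G₁≈G₀))
                        (⊛-cong (≈-refl {q^ (2 * suc (suc a))}) (qbinom-≡ a (suc (suc a)) (a + 2 * 1) (ℕ-Solver.solve (a ∷ [])))))
                (⊛-cong (≈-refl {q^ (2 * suc (suc a))})
                        (≈-trans (qbinom-sym (suc (suc a)) a) (qbinom-≡ a (suc (suc a)) (a + 2 * 1) (ℕ-Solver.solve (a ∷ []))))) ⟩
    G₀ ⊕ q^ (2 * suc (2 * (suc a + 0))) ⊛ G₀ ⊕ X ⊕ X ∎

jacobiClosedForm-subtop : ∀ j → JacobiClosedForm (suc j) →
  jacobiCoeff (suc (suc j)) (suc j) ≈ q^ (suc j * suc j) ⊛ qbinom 1 (1 + 2 * suc j)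
jacobiClosedForm-subtop j ih =
  jacobiCoeff-suc (suc j) (suc j) {q^ (suc j * suc j)} {one} {zeroˢ} {Y} {qbinom 1 (1 + 2 * suc j)}
    (ih 0 (suc j) refl)
    (⊛-vanishing (q^ (suc (2 * suc j))) (q^ (suc j * suc j)) (jacobiCoeff-vanish (suc j) (suc (suc j)) ℕP.≤-refl))
    (q^-shift-factor (suc (2 * suc j)) (j * j) (suc j * suc j) 2 (qbinom 1 (1 + 2 * j)) (ih 1 j refl) (ℕ-Solver.solve (j ∷ [])))
    target
  where
  open ≈-Reasoning
  Y = q^ 2 ⊛ qbinom 1 (1 + 2 * j)
  target : qbinom 1 (1 + 2 * suc j) ≈ one ⊕ q^ (2 * suc (2 * suc j)) ⊛ one ⊕ zeroˢ ⊕ Y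
  target = begin
    qbinom 1 (1 + 2 * suc j)
      ≈⟨ qbinom-≡ 1 (1 + 2 * suc j) (suc (suc (suc (2 * j)))) (ℕ-Solver.solve (j ∷ [])) ⟩
    qbinom 1 (suc (suc (suc (2 * j))))
      ≈⟨ qbinom-recurrence₃-edge (suc (2 * j)) ⟩
    one ⊕ q^ (2 * suc (suc (suc (2 * j)))) ⊛ one ⊕ Y
      ≈⟨ ⊕-cong (⊕-cong (≈-refl {one}) (⊛-cong (q^-≡ _ _ (ℕ-Solver.solve (j ∷ []))) (≈-refl {one}))) (≈-refl {Y}) ⟩
    one ⊕ q^ (2 * suc (2 * suc j)) ⊛ one ⊕ Y
      ≈⟨ ⊕-cong (⊕-identityʳ (one ⊕ q^ (2 * suc (2 * suc j)) ⊛ one)) (≈-refl {Y}) ⟨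
    one ⊕ q^ (2 * suc (2 * suc j)) ⊛ one ⊕ zeroˢ ⊕ Y ∎

jacobiClosedForm-interior : ∀ a j → JacobiClosedForm (suc a + suc j) →
  jacobiCoeff (suc (suc a + suc j)) (suc j) ≈ q^ (suc j * suc j) ⊛ qbinom (suc (suc a)) (suc (suc a) + 2 * suc j)
jacobiClosedForm-interior a j ih =
  jacobiCoeff-suc (suc a + suc j) (suc j) {q^ (suc j * suc j)} {G₀} {X₊} {X₋}
    {qbinom (suc (suc a)) (suc (suc a) + 2 * suc j)}
    (ih (suc a) (suc j) refl)
    (q^-shift-factor (suc (2 * (suc a + suc j))) (suc (suc j) * suc (suc j)) (suc j * suc j) (2 * suc (suc (a + 2 * suc j)))
                     (qbinom a (a + 2 * suc (suc j))) (ih a (suc (suc j)) (ℕP.+-suc a (suc j)))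
                     (ℕ-Solver.solve (a ∷ j ∷ [])))
    (q^-shift-factor (suc (2 * (suc a + suc j))) (j * j) (suc j * suc j) (2 * suc (suc a))
                     (qbinom (suc (suc a)) (suc (suc a) + 2 * j)) (ih (suc (suc a)) j (cong suc (sym (ℕP.+-suc a j))))
                     (ℕ-Solver.solve (a ∷ j ∷ [])))
    target
  where
  open ≈-Reasoning
  G₀ = qbinom (suc a) (suc (a + 2 * suc j))
  X₊ = q^ (2 * suc (suc (a + 2 * suc j))) ⊛ qbinom a (a + 2 * suc (suc j))
  X₋ = q^ (2 * suc (suc a)) ⊛ qbinom (suc (suc a)) (suc (suc a) + 2 * j)
  target : qbinom (suc (suc a)) (suc (suc (a + 2 * suc j))) ≈ G₀ ⊕ q^ (2 * suc (2 * (suc a + suc j))) ⊛ G₀ ⊕ X₊ ⊕ X₋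
  target = begin
    qbinom (suc (suc a)) (suc (suc (a + 2 * suc j)))
      ≈⟨ qbinom-recurrence₃ a (a + 2 * suc j) ⟩
    G₀ ⊕ q^ (2 * suc (suc (suc (a + (a + 2 * suc j))))) ⊛ G₀
    ⊕ q^ (2 * suc (suc (a + 2 * suc j))) ⊛ qbinom a (suc (suc (a + 2 * suc j)))
    ⊕ q^ (2 * suc (suc a)) ⊛ qbinom (suc (suc a)) (a + 2 * suc j)
      ≈⟨ ⊕-cong (⊕-cong (⊕-cong (≈-refl {G₀}) (⊛-cong (q^-≡ _ _ (ℕ-Solver.solve (a ∷ j ∷ []))) (≈-refl {G₀})))
                        (⊛-cong (≈-refl {q^ (2 * suc (suc (a + 2 * suc j)))})
                                (qbinom-≡ a (suc (suc (a + 2 * suc j))) (a + 2 * suc (suc j)) (ℕ-Solver.solve (a ∷ j ∷ [])))))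
                (⊛-cong (≈-refl {q^ (2 * suc (suc a))})
                        (qbinom-≡ (suc (suc a)) (a + 2 * suc j) (suc (suc a) + 2 * j) (ℕ-Solver.solve (a ∷ j ∷ [])))) ⟩
    G₀ ⊕ q^ (2 * suc (2 * (suc a + suc j))) ⊛ G₀ ⊕ X₊ ⊕ X₋ ∎

jacobiClosedForm-step : ∀ {N} a j → JacobiClosedForm N → suc a + j ≡ suc N →
  jacobiCoeff (suc N) j ≈ q^ (j * j) ⊛ qbinom (suc a) (suc a + 2 * j)
jacobiClosedForm-step zero zero ih refl =
  jacobiCoeff-suc 0 0 {q^ 0} {one} {zeroˢ} {zeroˢ} {qbinom 1 1}
    (ih 0 0 refl) (⊛-vanishing (q^ 1) (q^ 0) ≈-refl) (⊛-vanishing (q^ 1) (q^ 0) ≈-refl)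
    (≈-sym (≈-trans (⊕-identityʳ (one ⊕ q^ 2 ⊛ one ⊕ zeroˢ)) (⊕-identityʳ (one ⊕ q^ 2 ⊛ one))))
jacobiClosedForm-step (suc a) zero    ih refl = jacobiClosedForm-centre a ih
jacobiClosedForm-step zero    (suc j) ih refl = jacobiClosedForm-subtop j ih
jacobiClosedForm-step (suc a) (suc j) ih refl = jacobiClosedForm-interior a j ih

jacobiClosedForm : ∀ N → JacobiClosedForm N
jacobiClosedForm zero    zero    zero     refl = ≈-sym (≈-trans (⊛-cong q^0≈one (≈-refl {one})) (⊛-identityˡ one))
jacobiClosedForm (suc N) zero    .(suc N) refl = jacobiClosedForm-top N (jacobiClosedForm N)
jacobiClosedForm (suc N) (suc a) j        eq   = jacobiClosedForm-step a j (jacobiClosedForm N) eq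

-- Gauss's identity  f₁² = θ f₂  with  θ = Σ_{j∈ℤ} (-1)^j q^{j²}

altSum : ℕ → (ℕ → Series) → Series
altSum zero    c = c 0
altSum (suc L) c = c 0 ⊕ ⊝ altSum L (λ j → c (suc j))

altSum-cong : ∀ L {c d : ℕ → Series} → (∀ j → c j ≈ d j) → altSum L c ≈ altSum L d
altSum-cong zero    c≈d = c≈d 0
altSum-cong (suc L) c≈d = ⊕-cong (c≈d 0) (⊝-cong (altSum-cong L (λ j → c≈d (suc j))))

altSum-cong[] : ∀ L {c d : ℕ → Series} {K} → (∀ j → c j ≈[ K ] d j) → altSum L c ≈[ K ] altSum L d
altSum-cong[] zero    c≈d = c≈d 0
altSum-cong[] (suc L) c≈d = ⊕-cong[] (c≈d 0) (⊝-cong[] (altSum-cong[] L (λ j → c≈d (suc j))))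

altSum-⊕ : ∀ L (c d : ℕ → Series) → altSum L (λ j → c j ⊕ d j) ≈ altSum L c ⊕ altSum L d
altSum-⊕ zero    c d = ≈-refl
altSum-⊕ (suc L) c d = ≈-trans
  (⊕-cong (≈-refl {c 0 ⊕ d 0}) (⊝-cong (altSum-⊕ L (λ j → c (suc j)) (λ j → d (suc j)))))
  (interchange (c 0) (d 0) (altSum L (λ j → c (suc j))) (altSum L (λ j → d (suc j))))
  where
  interchange : ∀ a b x y → (a ⊕ b) ⊕ ⊝ (x ⊕ y) ≈ (a ⊕ ⊝ x) ⊕ (b ⊕ ⊝ y)
  interchange = solve 4 (λ a b x y → (a :+ b) :- (x :+ y) := (a :- x) :+ (b :- y)) ≈-refl
    where open SeriesSolver

altSum-⊛ : ∀ L x (c : ℕ → Series) → altSum L (λ j → x ⊛ c j) ≈ x ⊛ altSum L c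
altSum-⊛ zero    x c = ≈-refl
altSum-⊛ (suc L) x c = ≈-trans
  (⊕-cong (≈-refl {x ⊛ c 0}) (⊝-cong (altSum-⊛ L x (λ j → c (suc j)))))
  (factor x (c 0) (altSum L (λ j → c (suc j))))
  where
  factor : ∀ x a y → x ⊛ a ⊕ ⊝ (x ⊛ y) ≈ x ⊛ (a ⊕ ⊝ y)
  factor = solve 3 (λ x a y → x :* a :- x :* y := x :* (a :- y)) ≈-refl
    where open SeriesSolver

altSum-extend : ∀ L (c : ℕ → Series) {K} → c (suc L) ≈[ K ] zeroˢ → altSum (suc L) c ≈[ K ] altSum L c
altSum-extend zero    c c≈0 = ≈[]-trans (⊕-cong[] (≈[]-refl {c 0}) (⊝-cong[] c≈0)) (mk≈[] λ n _ → ℤP.+-identityʳ (c 0 n))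
altSum-extend (suc L) c c≈0 = ⊕-cong[] (≈[]-refl {c 0}) (⊝-cong[] (altSum-extend L (λ j → c (suc j)) c≈0))

altSum-extend-exact : ∀ L (c : ℕ → Series) → c (suc L) ≈ zeroˢ → altSum (suc L) c ≈ altSum L c
altSum-extend-exact L c c≈0 = mk≈ λ n → below (altSum-extend L c (≈⇒≈[] {K = suc n} c≈0)) n (ℕP.n<1+n n)

altSum-recurrence : ∀ L p x (a b c : ℕ → Series) →
  altSum L (λ j → a j ⊕ p ⊛ a j ⊕ x ⊛ b j ⊕ x ⊛ c j) ≈
  altSum L a ⊕ p ⊛ altSum L a ⊕ x ⊛ altSum L b ⊕ x ⊛ altSum L c
altSum-recurrence L p x a b c = begin
  altSum L (λ j → a j ⊕ p ⊛ a j ⊕ x ⊛ b j ⊕ x ⊛ c j)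
    ≈⟨ altSum-⊕ L (λ j → a j ⊕ p ⊛ a j ⊕ x ⊛ b j) (λ j → x ⊛ c j) ⟩
  altSum L (λ j → a j ⊕ p ⊛ a j ⊕ x ⊛ b j) ⊕ altSum L (λ j → x ⊛ c j)
    ≈⟨ ⊕-cong (altSum-⊕ L (λ j → a j ⊕ p ⊛ a j) (λ j → x ⊛ b j)) (altSum-⊛ L x c) ⟩
  altSum L (λ j → a j ⊕ p ⊛ a j) ⊕ altSum L (λ j → x ⊛ b j) ⊕ x ⊛ altSum L c
    ≈⟨ ⊕-cong (⊕-cong (altSum-⊕ L a (λ j → p ⊛ a j)) (altSum-⊛ L x b)) (≈-refl {x ⊛ altSum L c}) ⟩
  altSum L a ⊕ altSum L (λ j → p ⊛ a j) ⊕ x ⊛ altSum L b ⊕ x ⊛ altSum L c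
    ≈⟨ ⊕-cong (⊕-cong (⊕-cong (≈-refl {altSum L a}) (altSum-⊛ L p a)) (≈-refl {x ⊛ altSum L b})) (≈-refl {x ⊛ altSum L c}) ⟩
  altSum L a ⊕ p ⊛ altSum L a ⊕ x ⊛ altSum L b ⊕ x ⊛ altSum L c ∎
  where open ≈-Reasoning

-- atMinusOne N = Σ_{|j| ≤ N} (-1)^j jacobiCoeff N |j|, the product at z = -1.
atMinusOne : ℕ → Series
atMinusOne N = altSum N (jacobiCoeff N) ⊕ altSum N (jacobiCoeff N) ⊕ ⊝ jacobiCoeff N 0

oddFactors : ℕ → Series
oddFactors zero    = one
oddFactors (suc N) = oddFactors N ⊛ oneMinusQ (suc (2 * N))

altSum-jacobiCoeff-suc : ∀ N → let D = jacobiCoeff N ; m = q^ (suc (2 * N)) ; A = altSum N D in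
  altSum (suc N) (jacobiCoeff (suc N)) ≈ A ⊕ m ⊛ m ⊛ A ⊕ m ⊛ (D 0 ⊕ ⊝ A) ⊕ m ⊛ (D 1 ⊕ ⊝ A)
altSum-jacobiCoeff-suc N =
  ≈-trans (altSum-recurrence (suc N) (q^ (2 * suc (2 * N))) m D (λ j → D (suc j)) (previous D))
    (⊕-cong (⊕-cong (⊕-cong top (⊛-cong (q^-double (suc (2 * N))) top)) (⊛-cong (≈-refl {m}) shifted))
            (≈-refl {m ⊛ (D 1 ⊕ ⊝ A)}))
  where
  D = jacobiCoeff N
  m = q^ (suc (2 * N))
  A = altSum N D
  top : altSum (suc N) D ≈ A
  top = altSum-extend-exact N D (jacobiCoeff-vanish N (suc N) ℕP.≤-refl)
  shifted : altSum (suc N) (λ j → D (suc j)) ≈ D 0 ⊕ ⊝ A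
  shifted = ≈-trans (double-negation (D 0) (altSum (suc N) (λ j → D (suc j))))
    (⊕-cong (≈-refl {D 0}) (⊝-cong (≈-trans (altSum-extend-exact (suc N) D
                                      (jacobiCoeff-vanish N (suc (suc N)) (ℕP.m≤n⇒m≤1+n ℕP.≤-refl))) top)))
    where
    double-negation : ∀ d x → x ≈ d ⊕ ⊝ (d ⊕ ⊝ x)
    double-negation = solve 2 (λ d x → x := d :- (d :- x)) ≈-refl
      where open SeriesSolver

atMinusOne-suc : ∀ N →
  atMinusOne (suc N) ≈ (κ (+ 1) ⊕ ⊝ q^ (suc (2 * N))) ⊛ (κ (+ 1) ⊕ ⊝ q^ (suc (2 * N))) ⊛ atMinusOne N
atMinusOne-suc N = begin
  A′ ⊕ A′ ⊕ ⊝ jacobiCoeff (suc N) 0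
    ≈⟨ ⊕-cong (⊕-cong (altSum-jacobiCoeff-suc N) (altSum-jacobiCoeff-suc N)) (⊝-cong D′₀≈) ⟩
  (A ⊕ m ⊛ m ⊛ A ⊕ m ⊛ (d₀ ⊕ ⊝ A) ⊕ m ⊛ (d₁ ⊕ ⊝ A)) ⊕ (A ⊕ m ⊛ m ⊛ A ⊕ m ⊛ (d₀ ⊕ ⊝ A) ⊕ m ⊛ (d₁ ⊕ ⊝ A))
  ⊕ ⊝ (d₀ ⊕ m ⊛ m ⊛ d₀ ⊕ m ⊛ d₁ ⊕ m ⊛ d₁)
    ≈⟨ square-factor A d₀ d₁ m ⟩
  (κ (+ 1) ⊕ ⊝ m) ⊛ (κ (+ 1) ⊕ ⊝ m) ⊛ (A ⊕ A ⊕ ⊝ d₀) ∎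
  where
  open ≈-Reasoning
  m = q^ (suc (2 * N))
  A = altSum N (jacobiCoeff N)
  d₀ = jacobiCoeff N 0
  d₁ = jacobiCoeff N 1
  A′ = altSum (suc N) (jacobiCoeff (suc N))
  D′₀≈ : jacobiCoeff (suc N) 0 ≈ d₀ ⊕ m ⊛ m ⊛ d₀ ⊕ m ⊛ d₁ ⊕ m ⊛ d₁
  D′₀≈ = ⊕-cong (⊕-cong (⊕-cong (≈-refl {d₀}) (⊛-cong (q^-double (suc (2 * N))) (≈-refl {d₀}))) (≈-refl {m ⊛ d₁}))
                (≈-refl {m ⊛ d₁})
  square-factor : ∀ A d₀ d₁ m →
    (A ⊕ m ⊛ m ⊛ A ⊕ m ⊛ (d₀ ⊕ ⊝ A) ⊕ m ⊛ (d₁ ⊕ ⊝ A)) ⊕ (A ⊕ m ⊛ m ⊛ A ⊕ m ⊛ (d₀ ⊕ ⊝ A) ⊕ m ⊛ (d₁ ⊕ ⊝ A))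
    ⊕ ⊝ (d₀ ⊕ m ⊛ m ⊛ d₀ ⊕ m ⊛ d₁ ⊕ m ⊛ d₁)
    ≈ (κ (+ 1) ⊕ ⊝ m) ⊛ (κ (+ 1) ⊕ ⊝ m) ⊛ (A ⊕ A ⊕ ⊝ d₀)
  square-factor = solve 4 (λ A d₀ d₁ m →
    (A :+ m :* m :* A :+ m :* (d₀ :- A) :+ m :* (d₁ :- A)) :+ (A :+ m :* m :* A :+ m :* (d₀ :- A) :+ m :* (d₁ :- A))
    :- (d₀ :+ m :* m :* d₀ :+ m :* d₁ :+ m :* d₁)
    := (con (+ 1) :- m) :* (con (+ 1) :- m) :* (A :+ A :- d₀)) ≈-refl
    where open SeriesSolver

atMinusOne≈oddFactors² : ∀ N → atMinusOne N ≈ oddFactors N ⊛ oddFactors N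
atMinusOne≈oddFactors² zero = ≈-trans (cancel one) (≈-sym (⊛-identityˡ one))
  where
  cancel : ∀ x → x ⊕ x ⊕ ⊝ x ≈ x
  cancel = solve 1 (λ x → x :+ x :- x := x) ≈-refl
    where open SeriesSolver
atMinusOne≈oddFactors² (suc N) = begin
  atMinusOne (suc N)                                                 ≈⟨ atMinusOne-suc N ⟩
  (κ (+ 1) ⊕ ⊝ m) ⊛ (κ (+ 1) ⊕ ⊝ m) ⊛ atMinusOne N
    ≈⟨ ⊛-cong (⊛-cong (≈-sym o≈) (≈-sym o≈)) (atMinusOne≈oddFactors² N) ⟩
  oneMinusQ (suc (2 * N)) ⊛ oneMinusQ (suc (2 * N)) ⊛ (oddFactors N ⊛ oddFactors N)
    ≈⟨ rearrange (oddFactors N) (oneMinusQ (suc (2 * N))) ⟩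
  oddFactors (suc N) ⊛ oddFactors (suc N) ∎
  where
  open ≈-Reasoning
  m = q^ (suc (2 * N))
  o≈ : oneMinusQ (suc (2 * N)) ≈ κ (+ 1) ⊕ ⊝ m
  o≈ = oneMinusQ-expand (suc (2 * N))
  rearrange : ∀ a b → b ⊛ b ⊛ (a ⊛ a) ≈ (a ⊛ b) ⊛ (a ⊛ b)
  rearrange = solve 2 (λ a b → b :* b :* (a :* a) := (a :* b) :* (a :* b)) ≈-refl
    where open SeriesSolver

evenFactors : ℕ → Series
evenFactors a = prodTo a (λ k → oneMinusQ (2 * k))

evenFactors≈[]one : ∀ a → evenFactors a ≈[ 2 ] one
evenFactors≈[]one zero    = ≈[]-refl
evenFactors≈[]one (suc a) = ≈[]-trans
  (⊛-cong[] (evenFactors≈[]one a) (≈[]-weaken (ℕP.*-monoʳ-≤ 2 (s≤s z≤n)) (oneMinusQ≈[]one (2 * suc a))))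
  (≈⇒≈[] (⊛-identityʳ one))

-- [a+b choose a]_{q²} (q²;q²)_a = (q^{2b+2};q²)_a
qbinom⊛evenFactors : ∀ a b → qbinom a b ⊛ evenFactors a ≈[ 2 * suc b ] one
qbinom⊛evenFactors zero    b    = ≈⇒≈[] (⊛-identityʳ one)
qbinom⊛evenFactors (suc a) zero = ≈[]-trans (≈⇒≈[] (⊛-identityˡ (evenFactors (suc a)))) (evenFactors≈[]one (suc a))
qbinom⊛evenFactors (suc a) (suc b) = begin
  (g₁ ⊕ s ⊛ g₂) ⊛ (E ⊛ o)              ≈⟨ ≈⇒≈[] (distribute g₁ g₂ s E o) ⟩
  (g₁ ⊛ E) ⊛ o ⊕ s ⊛ (g₂ ⊛ (E ⊛ o))    ≈⟨ ⊕-cong[] (⊛-cong[] (qbinom⊛evenFactors a (suc b)) (≈[]-refl {o}))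
                                                 (≈[]-weaken 2[2+b]≤2[1+a]+2[1+b] (q^-shift-cong[] (2 * suc a) (qbinom⊛evenFactors (suc a) b))) ⟩
  one ⊛ o ⊕ s ⊛ one                     ≈⟨ ≈⇒≈[] telescope ⟩
  one                                   ∎
  where
  open ≈[]-Reasoning
  g₁ = qbinom a (suc b)
  g₂ = qbinom (suc a) b
  s = q^ (2 * suc a)
  E = evenFactors a
  o = oneMinusQ (2 * suc a)
  distribute : ∀ g₁ g₂ s E o → (g₁ ⊕ s ⊛ g₂) ⊛ (E ⊛ o) ≈ (g₁ ⊛ E) ⊛ o ⊕ s ⊛ (g₂ ⊛ (E ⊛ o))
  distribute = solve 5 (λ g₁ g₂ s E o → (g₁ :+ s :* g₂) :* (E :* o) := (g₁ :* E) :* o :+ s :* (g₂ :* (E :* o))) ≈-refl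
    where open SeriesSolver
  2[2+b]≤2[1+a]+2[1+b] : 2 * suc (suc b) ≤ 2 * suc a + 2 * suc b
  2[2+b]≤2[1+a]+2[1+b] = ℕP.≤-trans (ℕP.m≤n+m (2 * suc (suc b)) (2 * a)) (ℕP.≤-reflexive (ℕ-Solver.solve (a ∷ b ∷ [])))
  telescope : one ⊛ o ⊕ s ⊛ one ≈ one
  telescope = ≈-trans (⊕-cong (⊛-identityˡ o) (⊛-identityʳ s)) (oneMinusQ⊕q^ (2 * suc a))

qbinom⊛f₂ : ∀ a b → a ≤ b → qbinom a b ⊛ f 2 ≈[ 2 * suc a ] one
qbinom⊛f₂ a b a≤b = ≈[]-trans (⊛-cong[] (≈[]-refl {qbinom a b}) (f≈[]prodTo 2 a))
                              (≈[]-weaken (ℕP.*-monoʳ-≤ 2 (s≤s a≤b)) (qbinom⊛evenFactors a b))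

jacobiCoeff⊛f₂ : ∀ N j → jacobiCoeff N j ⊛ f 2 ≈[ suc (2 * N) ] q^ (j * j)
jacobiCoeff⊛f₂ N j with j ℕ.≤? N
... | yes j≤N = begin
  jacobiCoeff N j ⊛ f 2
    ≈⟨ ≈⇒≈[] (⊛-cong (jacobiClosedForm N a j a+j≡N) (≈-refl {f 2})) ⟩
  (q^ (j * j) ⊛ qbinom a (a + 2 * j)) ⊛ f 2
    ≈⟨ ≈⇒≈[] (⊛-assoc (q^ (j * j)) (qbinom a (a + 2 * j)) (f 2)) ⟩
  q^ (j * j) ⊛ (qbinom a (a + 2 * j) ⊛ f 2)
    ≈⟨ ≈[]-weaken (subst (λ M → suc (2 * M) ≤ j * j + 2 * suc a) a+j≡N (bound a j))
                  (q^-shift-cong[] (j * j) (qbinom⊛f₂ a (a + 2 * j) (ℕP.m≤m+n a (2 * j)))) ⟩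
  q^ (j * j) ⊛ one
    ≈⟨ ≈⇒≈[] (⊛-identityʳ (q^ (j * j))) ⟩
  q^ (j * j) ∎
  where
  open ≈[]-Reasoning
  a = N ∸ j
  a+j≡N : a + j ≡ N
  a+j≡N = ℕP.m∸n+n≡m j≤N
  bound : ∀ a j → suc (2 * (a + j)) ≤ j * j + 2 * suc a
  bound a zero    = ℕP.≤-trans (ℕP.n≤1+n _) (ℕP.≤-reflexive (ℕ-Solver.solve (a ∷ [])))
  bound a (suc j) = ℕP.≤-trans (ℕP.m≤m+n _ (j * j)) (ℕP.≤-reflexive (ℕ-Solver.solve (a ∷ j ∷ [])))
... | no j≰N = begin
  jacobiCoeff N j ⊛ f 2  ≈⟨ ≈⇒≈[] (⊛-cong (jacobiCoeff-vanish N j N<j) (≈-refl {f 2})) ⟩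
  zeroˢ ⊛ f 2            ≈⟨ ≈⇒≈[] (≈-trans (⊛-comm zeroˢ (f 2)) (⊛-zeroʳ (f 2))) ⟩
  zeroˢ                  ≈⟨ ≈[]-sym (≈[]-weaken 2N+1≤j² (q^≈[]zero (j * j))) ⟩
  q^ (j * j)             ∎
  where
  open ≈[]-Reasoning
  N<j : N < j
  N<j = ℕP.≰⇒> j≰N
  2N+1≤j² : suc (2 * N) ≤ j * j
  2N+1≤j² = ℕP.≤-trans (ℕP.m≤m+n (suc (2 * N)) (N * N)) (ℕP.≤-trans (ℕP.≤-reflexive square) (ℕP.*-mono-≤ N<j N<j))
    where
    square : suc (2 * N) + N * N ≡ suc N * suc N
    square = ℕ-Solver.solve (N ∷ [])

-- thetaPartial N = Σ_{|j| ≤ N} (-1)^j q^{j²}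
thetaPartial : ℕ → Series
thetaPartial N = altSum N (λ j → q^ (j * j)) ⊕ altSum N (λ j → q^ (j * j)) ⊕ ⊝ q^ 0

θ : Series
θ = diagonal thetaPartial

atMinusOne⊛f₂ : ∀ N → atMinusOne N ⊛ f 2 ≈[ suc (2 * N) ] thetaPartial N
atMinusOne⊛f₂ N = begin
  (A ⊕ A ⊕ ⊝ D 0) ⊛ f 2                          ≈⟨ ≈⇒≈[] (distribute A (D 0) (f 2)) ⟩
  A ⊛ f 2 ⊕ A ⊛ f 2 ⊕ ⊝ (D 0 ⊛ f 2)              ≈⟨ ⊕-cong[] (⊕-cong[] A⊛f₂ A⊛f₂) (⊝-cong[] (jacobiCoeff⊛f₂ N 0)) ⟩
  thetaPartial N                                 ∎
  where
  open ≈[]-Reasoning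
  D = jacobiCoeff N
  A = altSum N D
  A⊛f₂ : A ⊛ f 2 ≈[ suc (2 * N) ] altSum N (λ j → q^ (j * j))
  A⊛f₂ = ≈[]-trans (≈⇒≈[] (≈-trans (⊛-comm A (f 2)) (≈-sym (≈-trans (altSum-cong N (λ j → ⊛-comm (D j) (f 2)))
                                                                   (altSum-⊛ N (f 2) D)))))
                   (altSum-cong[] N (jacobiCoeff⊛f₂ N))
  distribute : ∀ a d f → (a ⊕ a ⊕ ⊝ d) ⊛ f ≈ a ⊛ f ⊕ a ⊛ f ⊕ ⊝ (d ⊛ f)
  distribute = solve 3 (λ a d f → (a :+ a :- d) :* f := a :* f :+ a :* f :- d :* f) ≈-refl
    where open SeriesSolver

thetaPartial-stable : ∀ N d → thetaPartial (d + N) ≈[ suc N * suc N ] thetaPartial N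
thetaPartial-stable N d = ⊕-cong[] (⊕-cong[] (squares-stable d) (squares-stable d)) (≈[]-refl {⊝ q^ 0})
  where
  squares-stable : ∀ d → altSum (d + N) (λ j → q^ (j * j)) ≈[ suc N * suc N ] altSum N (λ j → q^ (j * j))
  squares-stable zero    = ≈[]-refl
  squares-stable (suc d) = ≈[]-trans (altSum-extend (d + N) (λ j → q^ (j * j)) (≈[]-weaken N+1≤ (q^≈[]zero _)))
                                     (squares-stable d)
    where
    N+1≤ : suc N * suc N ≤ suc (d + N) * suc (d + N)
    N+1≤ = ℕP.*-mono-≤ (s≤s (ℕP.m≤n+m N d)) (s≤s (ℕP.m≤n+m N d))

θ≈[]thetaPartial : ∀ N → θ ≈[ suc N * suc N ] thetaPartial N
θ≈[]thetaPartial = diagonal-truncate thetaPartial (λ N → suc N * suc N)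
  (λ N → ℕP.<-≤-trans (ℕP.n<1+n N) (ℕP.m≤m*n (suc N) (suc N))) thetaPartial-stable

oddFactors⊛evenFactors : ∀ N → oddFactors N ⊛ evenFactors N ≈ prodTo (2 * N) (λ k → oneMinusQ (1 * k))
oddFactors⊛evenFactors zero    = ⊛-identityˡ one
oddFactors⊛evenFactors (suc N) = begin
  (oddFactors N ⊛ o) ⊛ (evenFactors N ⊛ e)    ≈⟨ interchange (oddFactors N) o (evenFactors N) e ⟩
  (oddFactors N ⊛ evenFactors N) ⊛ o ⊛ e
    ≈⟨ ⊛-cong (⊛-cong (oddFactors⊛evenFactors N) (reindex (ℕP.*-identityˡ (suc (2 * N))))) (reindex 2[N+1]≡) ⟩
  prodTo (suc (suc (2 * N))) (λ k → oneMinusQ (1 * k))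
    ≈⟨ ≡⇒≈ (cong (λ M → prodTo M (λ k → oneMinusQ (1 * k))) 2N+2≡) ⟩
  prodTo (2 * suc N) (λ k → oneMinusQ (1 * k)) ∎
  where
  open ≈-Reasoning
  o = oneMinusQ (suc (2 * N))
  e = oneMinusQ (2 * suc N)
  reindex : ∀ {k k′} → k′ ≡ k → oneMinusQ k ≈ oneMinusQ k′
  reindex k′≡k = ≡⇒≈ (cong oneMinusQ (sym k′≡k))
  2[N+1]≡ : 1 * suc (suc (2 * N)) ≡ 2 * suc N
  2[N+1]≡ = ℕ-Solver.solve (N ∷ [])
  2N+2≡ : suc (suc (2 * N)) ≡ 2 * suc N
  2N+2≡ = ℕ-Solver.solve (N ∷ [])
  interchange : ∀ a b c d → (a ⊛ b) ⊛ (c ⊛ d) ≈ (a ⊛ c) ⊛ b ⊛ d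
  interchange = solve 4 (λ a b c d → (a :* b) :* (c :* d) := (a :* c) :* b :* d) ≈-refl
    where open SeriesSolver

gauss-identity : f 1 ⊛ f 1 ≈ θ ⊛ f 2
gauss-identity = mk≈ λ n → below (truncated n) n (s≤s (ℕP.m≤m+n n _))
  where
  truncated : ∀ N → f 1 ⊛ f 1 ≈[ suc (2 * N) ] θ ⊛ f 2
  truncated N = begin
    f 1 ⊛ f 1                                            ≈⟨ ⊛-cong[] f₁≈ f₁≈ ⟩
    (oddFactors N ⊛ E) ⊛ (oddFactors N ⊛ E)              ≈⟨ ≈⇒≈[] (rearrange (oddFactors N) E) ⟩
    (oddFactors N ⊛ oddFactors N) ⊛ E ⊛ E
      ≈⟨ ≈⇒≈[] (⊛-cong (⊛-cong (≈-sym (atMinusOne≈oddFactors² N)) (≈-refl {E})) (≈-refl {E})) ⟩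
    atMinusOne N ⊛ E ⊛ E                                 ≈⟨ ⊛-cong[] (⊛-cong[] (≈[]-refl {atMinusOne N}) f₂≈) f₂≈ ⟨
    atMinusOne N ⊛ f 2 ⊛ f 2                             ≈⟨ ⊛-cong[] (atMinusOne⊛f₂ N) (≈[]-refl {f 2}) ⟩
    thetaPartial N ⊛ f 2                                 ≈⟨ ⊛-cong[] (≈[]-weaken 2N+1≤[N+1]² (θ≈[]thetaPartial N)) (≈[]-refl {f 2}) ⟨
    θ ⊛ f 2                                              ∎
    where
    open ≈[]-Reasoning
    E = evenFactors N
    f₁≈ : f 1 ≈[ suc (2 * N) ] oddFactors N ⊛ E
    f₁≈ = ≈[]-trans (≈[]-weaken (ℕP.≤-reflexive (sym (ℕP.*-identityˡ _))) (f≈[]prodTo 1 (2 * N)))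
                    (≈⇒≈[] (≈-sym (oddFactors⊛evenFactors N)))
    f₂≈ : f 2 ≈[ suc (2 * N) ] E
    f₂≈ = ≈[]-weaken (ℕP.≤-trans (ℕP.n≤1+n _) (ℕP.≤-reflexive 2N+2≡)) (f≈[]prodTo 2 N)
      where
      2N+2≡ : suc (suc (2 * N)) ≡ 2 * suc N
      2N+2≡ = ℕ-Solver.solve (N ∷ [])
    2N+1≤[N+1]² : suc (2 * N) ≤ suc N * suc N
    2N+1≤[N+1]² = ℕP.≤-trans (ℕP.m≤m+n (suc (2 * N)) (N * N)) (ℕP.≤-reflexive (ℕ-Solver.solve (N ∷ [])))
    rearrange : ∀ a b → (a ⊛ b) ⊛ (a ⊛ b) ≈ (a ⊛ a) ⊛ b ⊛ b
    rearrange = solve 2 (λ a b → (a :* b) :* (a :* b) := (a :* a) :* b :* b) ≈-refl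
      where open SeriesSolver

-- Series in q²

even⊎odd : ∀ i → (∃[ h ] i ≡ 2 * h) ⊎ (∃[ h ] i ≡ suc (2 * h))
even⊎odd zero = inj₁ (0 , refl)
even⊎odd (suc i) with even⊎odd i
... | inj₁ (h , i≡2h)   = inj₂ (h , cong suc i≡2h)
... | inj₂ (h , i≡2h+1) = inj₁ (suc h , trans (cong suc i≡2h+1) (sym (ℕP.*-suc 2 h)))

even≢odd : ∀ a b → 2 * a ≢ suc (2 * b)
even≢odd zero    b       ()
even≢odd (suc a) zero    eq = ℕP.0≢1+n (sym (ℕP.suc-injective (trans (sym (ℕP.*-suc 2 a)) eq)))
even≢odd (suc a) (suc b) eq =
  even≢odd a b (ℕP.suc-injective (ℕP.suc-injective (trans (sym (ℕP.*-suc 2 a)) (trans eq (cong suc (ℕP.*-suc 2 b))))))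

odd∸even : ∀ h d → suc (2 * (h + d)) ∸ 2 * h ≡ suc (2 * (h + d ∸ h))
odd∸even h d = begin
  suc (2 * (h + d)) ∸ 2 * h    ≡⟨ cong (_∸ 2 * h) split ⟩
  2 * h + suc (2 * d) ∸ 2 * h  ≡⟨ ℕP.m+n∸m≡n (2 * h) (suc (2 * d)) ⟩
  suc (2 * d)                  ≡⟨ cong (λ x → suc (2 * x)) (ℕP.m+n∸m≡n h d) ⟨
  suc (2 * (h + d ∸ h))        ∎
  where
  open ≡-Reasoning
  split : suc (2 * (h + d)) ≡ 2 * h + suc (2 * d)
  split = ℕ-Solver.solve (h ∷ d ∷ [])

record Even (s : Series) : Set where
  constructor mkEven
  field odd-coefficient : ∀ k → s (suc (2 * k)) ≡ + 0
open Even public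

⊛-Even : ∀ {s t} → Even s → Even t → Even (s ⊛ t)
⊛-Even {s} {t} s-even t-even = mkEven λ k → sumTo-zero (suc (2 * k)) (term k)
  where
  term : ∀ k i → i ≤ suc (2 * k) → s i ℤ.* t (suc (2 * k) ∸ i) ≡ + 0
  term k i i≤ with even⊎odd i
  ... | inj₂ (h , refl) = cong (ℤ._* t (suc (2 * k) ∸ suc (2 * h))) (odd-coefficient s-even h)
  ... | inj₁ (h , refl) = trans (cong (s (2 * h) ℤ.*_) (trans (cong t complement) (odd-coefficient t-even (k ∸ h))))
                                (ℤP.*-zeroʳ (s (2 * h)))
    where
    h≤k : h ≤ k
    h≤k = ℕP.≤-pred (ℕP.*-cancelˡ-< 2 h (suc k)
            (ℕP.≤-<-trans i≤ (subst (suc (2 * k) <_) (sym (ℕP.*-suc 2 k)) (ℕP.n<1+n _))))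
    complement : suc (2 * k) ∸ 2 * h ≡ suc (2 * (k ∸ h))
    complement = subst (λ x → suc (2 * x) ∸ 2 * h ≡ suc (2 * (x ∸ h))) (ℕP.m+[n∸m]≡n h≤k) (odd∸even h (k ∸ h))

one-Even : Even one
one-Even = mkEven λ _ → refl

pow-Even : ∀ {s} → Even s → ∀ e → Even (pow s e)
pow-Even s-even zero    = one-Even
pow-Even s-even (suc e) = ⊛-Even (pow-Even s-even e) s-even

prodTo-Even : ∀ {F : ℕ → Series} → (∀ k → Even (F (suc k))) → ∀ N → Even (prodTo N F)
prodTo-Even F-even zero    = one-Even
prodTo-Even F-even (suc N) = ⊛-Even (prodTo-Even F-even N) (F-even N)

diagonal-Even : ∀ {s : ℕ → Series} → (∀ N → Even (s N)) → Even (diagonal s)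
diagonal-Even s-even = mkEven λ k → odd-coefficient (s-even (suc (2 * k))) k

oneMinusQ-Even : ∀ a → Even (oneMinusQ (2 * a))
oneMinusQ-Even a = mkEven odd
  where
  odd : ∀ k → oneMinusQ (2 * a) (suc (2 * k)) ≡ + 0
  odd k with suc (2 * k) ℕ.≟ 2 * a
  ... | yes odd≡even = ⊥-elim (even≢odd a k (sym odd≡even))
  ... | no _         = refl

geom-Even : ∀ a → Even (geom (2 * a))
geom-Even a = mkEven λ k → geom-at-non-multiple (2 * a) (suc (2 * k)) λ 2a∣odd →
  let ND.divides c odd≡c*2 = ND.∣-trans (ND.divides a (ℕP.*-comm 2 a)) 2a∣odd
  in even≢odd c k (trans (ℕP.*-comm 2 c) (sym odd≡c*2))

f-Even : ∀ h → Even (f (2 * h))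
f-Even h = diagonal-Even (prodTo-Even λ k →
  subst (λ a → Even (oneMinusQ a)) (sym (ℕP.*-assoc 2 h (suc k))) (oneMinusQ-Even (h * suc k)))

finv-Even : ∀ h → Even (finv (2 * h))
finv-Even h = diagonal-Even (prodTo-Even λ k →
  subst (λ a → Even (geom a)) (sym (ℕP.*-assoc 2 h (suc k))) (geom-Even (h * suc k)))

-- Congruences between series

infix 4 _≡ˢ_[mod_]
record _≡ˢ_[mod_] (s t : Series) (c : ℤ) : Set where
  constructor mk≡ˢ
  field
    quotient : Series
    split    : s ≈ t ⊕ κ c ⊛ quotient
open _≡ˢ_[mod_] public

≈⇒≡ˢ : ∀ {s t c} → s ≈ t → s ≡ˢ t [mod c ]
≈⇒≡ˢ {t = t} {c} s≈t = mk≡ˢ zeroˢ (≈-trans s≈t (≈-sym (≈-trans (⊕-cong (≈-refl {t}) (⊛-zeroʳ (κ c))) (⊕-identityʳ t))))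

≡ˢ-respˡ : ∀ {s s′ t c} → s ≈ s′ → s′ ≡ˢ t [mod c ] → s ≡ˢ t [mod c ]
≡ˢ-respˡ s≈s′ (mk≡ˢ u s′≈) = mk≡ˢ u (≈-trans s≈s′ s′≈)

≡ˢ-respʳ : ∀ {s t t′ c} → s ≡ˢ t [mod c ] → t ≈ t′ → s ≡ˢ t′ [mod c ]
≡ˢ-respʳ {c = c} (mk≡ˢ u s≈) t≈t′ = mk≡ˢ u (≈-trans s≈ (⊕-cong t≈t′ (≈-refl {κ c ⊛ u})))

≡ˢ-⊛ : ∀ {s s′ t t′ c} → s ≡ˢ s′ [mod c ] → t ≡ˢ t′ [mod c ] → s ⊛ t ≡ˢ s′ ⊛ t′ [mod c ]
≡ˢ-⊛ {s′ = s′} {t′ = t′} {c} (mk≡ˢ u s≈) (mk≡ˢ v t≈) =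
  mk≡ˢ (u ⊛ t′ ⊕ s′ ⊛ v ⊕ κ c ⊛ (u ⊛ v)) (≈-trans (⊛-cong s≈ t≈) (expand s′ t′ u v (κ c)))
  where
  expand : ∀ s t u v c → (s ⊕ c ⊛ u) ⊛ (t ⊕ c ⊛ v) ≈ s ⊛ t ⊕ c ⊛ (u ⊛ t ⊕ s ⊛ v ⊕ c ⊛ (u ⊛ v))
  expand = solve 5 (λ s t u v c → (s :+ c :* u) :* (t :+ c :* v) := s :* t :+ c :* (u :* t :+ s :* v :+ c :* (u :* v))) ≈-refl
    where open SeriesSolver

≡ˢ-square : ∀ {s t} → s ≡ˢ t [mod + 2 ] → s ⊛ s ≡ˢ t ⊛ t [mod + 4 ]
≡ˢ-square {t = t} (mk≡ˢ u s≈) = mk≡ˢ (t ⊛ u ⊕ u ⊛ u) (≈-trans (⊛-cong s≈ s≈) (expand t u))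
  where
  expand : ∀ t u → (t ⊕ κ (+ 2) ⊛ u) ⊛ (t ⊕ κ (+ 2) ⊛ u) ≈ t ⊛ t ⊕ κ (+ 4) ⊛ (t ⊛ u ⊕ u ⊛ u)
  expand = solve 2 (λ t u → (t :+ con (+ 2) :* u) :* (t :+ con (+ 2) :* u) := t :* t :+ con (+ 4) :* (t :* u :+ u :* u)) ≈-refl
    where open SeriesSolver

pow-≡ˢ : ∀ {s t c} e → s ≡ˢ t [mod c ] → pow s e ≡ˢ pow t e [mod c ]
pow-≡ˢ zero    s≡t = ≈⇒≡ˢ ≈-refl
pow-≡ˢ (suc e) s≡t = ≡ˢ-⊛ (pow-≡ˢ e s≡t) s≡t

prodTo-≡ˢ : ∀ {F G : ℕ → Series} {c} → (∀ k → F (suc k) ≡ˢ G (suc k) [mod c ]) →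
  ∀ N → prodTo N F ≡ˢ prodTo N G [mod c ]
prodTo-≡ˢ F≡G zero    = ≈⇒≡ˢ ≈-refl
prodTo-≡ˢ F≡G (suc N) = ≡ˢ-⊛ (prodTo-≡ˢ F≡G N) (F≡G N)

diagonal-≡ˢ : ∀ {s t : ℕ → Series} {c} → (∀ N → s N ≡ˢ t N [mod c ]) → diagonal s ≡ˢ diagonal t [mod c ]
diagonal-≡ˢ {s} {t} {c} s≡t = mk≡ˢ (diagonal (λ N → quotient (s≡t N))) (mk≈ λ n →
  trans (at (split (s≡t n)) n)
        (cong (ℤ._+_ (t n n)) (trans (κ-scale c (quotient (s≡t n)) n) (sym (κ-scale c (diagonal (λ N → quotient (s≡t N))) n)))))

≡ˢ⇒∣ : ∀ {s t c} → s ≡ˢ t [mod c ] → ∀ n → c ∣ℤ s n ℤ.- t n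
≡ˢ⇒∣ {s} {t} {c} (mk≡ˢ u s≈) n = ℤ∣.divides (u n) (begin
  s n ℤ.- t n                    ≡⟨ cong (ℤ._- t n) (at s≈ n) ⟩
  t n ℤ.+ (κ c ⊛ u) n ℤ.- t n    ≡⟨ cong (λ x → t n ℤ.+ x ℤ.- t n) (κ-scale c u n) ⟩
  t n ℤ.+ c ℤ.* u n ℤ.- t n      ≡⟨ cancel (t n) c (u n) ⟩
  u n ℤ.* c                      ∎)
  where
  open ≡-Reasoning
  cancel : ∀ a c b → a ℤ.+ c ℤ.* b ℤ.- a ≡ b ℤ.* c
  cancel = ℤ-Solver.solve-∀

-- The generating function of ā_{2m+1} modulo 8

open import Algebra.Properties.CommutativeSemiring.Exp (CommutativeRing.commutativeSemiring seriesRing)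
  using (^-congˡ; ^-assocʳ; ^-distrib-*) renaming (_^_ to _^ˢ_)

pow≈^ : ∀ s e → pow s e ≈ s ^ˢ e
pow≈^ s zero    = ≈-refl
pow≈^ s (suc e) = ≈-trans (⊛-cong (pow≈^ s e) (≈-refl {s})) (⊛-comm (s ^ˢ e) s)

pow-⊛ : ∀ s t e → pow (s ⊛ t) e ≈ pow s e ⊛ pow t e
pow-⊛ s t e = ≈-trans (pow≈^ (s ⊛ t) e)
  (≈-trans (^-distrib-* s t e) (≈-sym (⊛-cong (pow≈^ s e) (pow≈^ t e))))

pow-pow : ∀ s a b → pow (pow s a) b ≈ pow s (a * b)
pow-pow s a b = ≈-trans (pow≈^ (pow s a) b)
  (≈-trans (^-congˡ b (pow≈^ s a)) (≈-trans (^-assocʳ s a b) (≈-sym (pow≈^ s (a * b)))))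

pow-cong : ∀ {s t} e → s ≈ t → pow s e ≈ pow t e
pow-cong zero    s≈t = ≈-refl
pow-cong (suc e) s≈t = ⊛-cong (pow-cong e s≈t) s≈t

pow-one : ∀ e → pow one e ≈ one
pow-one zero    = ≈-refl
pow-one (suc e) = ≈-trans (⊛-identityʳ (pow one e)) (pow-one e)

pow-4 : ∀ a → pow a 4 ≈ (a ⊛ a) ⊛ (a ⊛ a)
pow-4 a = ≈-trans (⊛-cong (⊛-cong (⊛-cong (⊛-identityˡ a) (≈-refl {a})) (≈-refl {a})) (≈-refl {a})) (regroup a)
  where
  regroup : ∀ a → a ⊛ a ⊛ a ⊛ a ≈ (a ⊛ a) ⊛ (a ⊛ a)
  regroup = solve 1 (λ a → a :* a :* a :* a := (a :* a) :* (a :* a)) ≈-refl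
    where open SeriesSolver

f₂/f₁² : Series
f₂/f₁² = f 2 ⊛ pow (finv 1) 2

f₄²/f₂⁴ : Series
f₄²/f₂⁴ = pow (f 4) 2 ⊛ pow (finv 2) 4

zpow-f₂ : ∀ m → zpow (f 2) (finv 2) (+ 3 ℤ.- + (2 * (2 * m + 1))) ≈ f 2 ⊛ pow (finv 2) (4 * m)
zpow-f₂ zero    = ≈-trans (⊛-identityˡ (f 2)) (≈-sym (⊛-identityʳ (f 2)))
zpow-f₂ (suc m) = begin
  zpow (f 2) (finv 2) (+ 3 ℤ.- + (2 * (2 * suc m + 1)))   ≡⟨ cong (λ e → zpow (f 2) (finv 2) (+ 3 ℤ.- + e)) exponent ⟩
  pow g (3 + 4 * m)                                       ≈⟨ ⊛-identityʳ (pow g (3 + 4 * m)) ⟨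
  pow g (3 + 4 * m) ⊛ one                                 ≈⟨ ⊛-cong (≈-refl {pow g (3 + 4 * m)}) (f⊛finv 2) ⟨
  pow g (3 + 4 * m) ⊛ (f 2 ⊛ g)                           ≈⟨ rearrange (pow g (3 + 4 * m)) (f 2) g ⟩
  f 2 ⊛ pow g (4 + 4 * m)                                 ≡⟨ cong (λ e → f 2 ⊛ pow g e) 4+4m≡4[1+m] ⟩
  f 2 ⊛ pow g (4 * suc m)                                 ∎
  where
  open ≈-Reasoning
  g = finv 2
  exponent : 2 * (2 * suc m + 1) ≡ 6 + 4 * m
  exponent = ℕ-Solver.solve (m ∷ [])
  4+4m≡4[1+m] : 4 + 4 * m ≡ 4 * suc m
  4+4m≡4[1+m] = ℕ-Solver.solve (m ∷ [])
  rearrange : ∀ a f g → a ⊛ (f ⊛ g) ≈ f ⊛ (a ⊛ g)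
  rearrange = solve 3 (λ a f g → a :* (f :* g) := f :* (a :* g)) ≈-refl
    where open SeriesSolver

abar-odd≈ : ∀ m → abar (2 * m + 1) ≈ f₂/f₁² ⊛ pow f₄²/f₂⁴ m
abar-odd≈ m = begin
  pow (f 4) (2 * m + 1 ∸ 1) ⊛ pow (finv 1) 2 ⊛ zpow (f 2) (finv 2) (+ 3 ℤ.- + (2 * (2 * m + 1)))
    ≡⟨ cong (λ e → pow (f 4) e ⊛ pow (finv 1) 2 ⊛ zpow (f 2) (finv 2) (+ 3 ℤ.- + (2 * (2 * m + 1))))
            (ℕP.m+n∸n≡m (2 * m) 1) ⟩
  pow (f 4) (2 * m) ⊛ pow (finv 1) 2 ⊛ zpow (f 2) (finv 2) (+ 3 ℤ.- + (2 * (2 * m + 1)))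
    ≈⟨ ⊛-cong (≈-refl {pow (f 4) (2 * m) ⊛ pow (finv 1) 2}) (zpow-f₂ m) ⟩
  pow (f 4) (2 * m) ⊛ pow (finv 1) 2 ⊛ (f 2 ⊛ pow (finv 2) (4 * m))
    ≈⟨ rearrange (pow (f 4) (2 * m)) (pow (finv 1) 2) (f 2) (pow (finv 2) (4 * m)) ⟩
  f₂/f₁² ⊛ (pow (f 4) (2 * m) ⊛ pow (finv 2) (4 * m))
    ≈⟨ ⊛-cong (≈-refl {f₂/f₁²}) (⊛-cong (pow-pow (f 4) 2 m) (pow-pow (finv 2) 4 m)) ⟨
  f₂/f₁² ⊛ (pow (pow (f 4) 2) m ⊛ pow (pow (finv 2) 4) m)
    ≈⟨ ⊛-cong (≈-refl {f₂/f₁²}) (pow-⊛ (pow (f 4) 2) (pow (finv 2) 4) m) ⟨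
  f₂/f₁² ⊛ pow f₄²/f₂⁴ m ∎
  where
  open ≈-Reasoning
  rearrange : ∀ a b f g → a ⊛ b ⊛ (f ⊛ g) ≈ (f ⊛ b) ⊛ (a ⊛ g)
  rearrange = solve 4 (λ a b f g → a :* b :* (f :* g) := (f :* b) :* (a :* g)) ≈-refl
    where open SeriesSolver

f₄≡f₂² : f 4 ≡ˢ f 2 ⊛ f 2 [mod + 2 ]
f₄≡f₂² = ≡ˢ-respʳ (diagonal-≡ˢ {s = λ N → prodTo N (λ k → oneMinusQ (4 * k))}
                               {t = λ N → prodTo N (λ k → oneMinusQ (2 * k) ⊛ oneMinusQ (2 * k))}
                               (prodTo-≡ˢ factor))
                  (≈-sym (f⊛f 2))
  where
  factor : ∀ k → oneMinusQ (4 * suc k) ≡ˢ oneMinusQ (2 * suc k) ⊛ oneMinusQ (2 * suc k) [mod + 2 ]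
  factor k = mk≡ˢ (m ⊕ ⊝ (m ⊛ m)) (begin
    oneMinusQ (4 * suc k)                        ≈⟨ oneMinusQ-expand (4 * suc k) ⟩
    κ (+ 1) ⊕ ⊝ q^ (4 * suc k)                   ≈⟨ ⊕-cong (≈-refl {κ (+ 1)}) (⊝-cong (q^-+ _ _ 4[1+k]≡) ) ⟨
    κ (+ 1) ⊕ ⊝ (m ⊛ m)                          ≈⟨ expand m ⟩
    (κ (+ 1) ⊕ ⊝ m) ⊛ (κ (+ 1) ⊕ ⊝ m) ⊕ κ (+ 2) ⊛ (m ⊕ ⊝ (m ⊛ m))
      ≈⟨ ⊕-cong (⊛-cong o≈ o≈) (≈-refl {κ (+ 2) ⊛ (m ⊕ ⊝ (m ⊛ m))}) ⟨
    oneMinusQ (2 * suc k) ⊛ oneMinusQ (2 * suc k) ⊕ κ (+ 2) ⊛ (m ⊕ ⊝ (m ⊛ m)) ∎)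
    where
    open ≈-Reasoning
    m = q^ (2 * suc k)
    o≈ : oneMinusQ (2 * suc k) ≈ κ (+ 1) ⊕ ⊝ m
    o≈ = oneMinusQ-expand (2 * suc k)
    4[1+k]≡ : 2 * suc k + 2 * suc k ≡ 4 * suc k
    4[1+k]≡ = ℕ-Solver.solve (k ∷ [])
    expand : ∀ m → κ (+ 1) ⊕ ⊝ (m ⊛ m) ≈ (κ (+ 1) ⊕ ⊝ m) ⊛ (κ (+ 1) ⊕ ⊝ m) ⊕ κ (+ 2) ⊛ (m ⊕ ⊝ (m ⊛ m))
    expand = solve 1 (λ m → con (+ 1) :- m :* m := (con (+ 1) :- m) :* (con (+ 1) :- m) :+ con (+ 2) :* (m :- m :* m)) ≈-refl
      where open SeriesSolver

f₄²/f₂⁴≡1 : f₄²/f₂⁴ ≡ˢ one [mod + 4 ]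
f₄²/f₂⁴≡1 = ≡ˢ-respˡ (⊛-cong (⊛-cong (⊛-identityˡ (f 4)) (≈-refl {f 4})) (≈-refl {pow g 4}))
              (≡ˢ-respʳ (≡ˢ-⊛ (≡ˢ-square f₄≡f₂²) (≈⇒≡ˢ (≈-refl {pow g 4}))) cancel)
  where
  g = finv 2
  cancel : (f 2 ⊛ f 2) ⊛ (f 2 ⊛ f 2) ⊛ pow g 4 ≈ one
  cancel = begin
    (f 2 ⊛ f 2) ⊛ (f 2 ⊛ f 2) ⊛ pow g 4   ≈⟨ ⊛-cong (pow-4 (f 2)) (≈-refl {pow g 4}) ⟨
    pow (f 2) 4 ⊛ pow g 4                 ≈⟨ pow-⊛ (f 2) g 4 ⟨
    pow (f 2 ⊛ g) 4                       ≈⟨ pow-cong 4 (f⊛finv 2) ⟩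
    pow one 4                             ≈⟨ pow-one 4 ⟩
    one                                   ∎
    where open ≈-Reasoning

f₄²/f₂⁴-Even : Even f₄²/f₂⁴
f₄²/f₂⁴-Even = ⊛-Even (pow-Even (f-Even 2) 2) (pow-Even (finv-Even 1) 4)

f₂/f₁²⊛θ : f₂/f₁² ⊛ θ ≈ one
f₂/f₁²⊛θ = begin
  f 2 ⊛ (one ⊛ b ⊛ b) ⊛ θ        ≈⟨ ⊛-cong (⊛-cong (≈-refl {f 2}) (⊛-cong (⊛-identityˡ b) (≈-refl {b}))) (≈-refl {θ}) ⟩
  f 2 ⊛ (b ⊛ b) ⊛ θ              ≈⟨ rearrange (f 2) b θ ⟩
  (θ ⊛ f 2) ⊛ (b ⊛ b)            ≈⟨ ⊛-cong gauss-identity (≈-refl {b ⊛ b}) ⟨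
  (f 1 ⊛ f 1) ⊛ (b ⊛ b)          ≈⟨ interchange (f 1) (f 1) b b ⟩
  (f 1 ⊛ b) ⊛ (f 1 ⊛ b)          ≈⟨ ⊛-cong (f⊛finv 1) (f⊛finv 1) ⟩
  one ⊛ one                      ≈⟨ ⊛-identityˡ one ⟩
  one                            ∎
  where
  open ≈-Reasoning
  b = finv 1
  rearrange : ∀ a b t → a ⊛ (b ⊛ b) ⊛ t ≈ (t ⊛ a) ⊛ (b ⊛ b)
  rearrange = solve 3 (λ a b t → a :* (b :* b) :* t := (t :* a) :* (b :* b)) ≈-refl
    where open SeriesSolver
  interchange : ∀ a b c d → (a ⊛ b) ⊛ (c ⊛ d) ≈ (a ⊛ c) ⊛ (b ⊛ d)
  interchange = solve 4 (λ a b c d → (a :* b) :* (c :* d) := (a :* c) :* (b :* d)) ≈-refl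
    where open SeriesSolver

-- S = Σ_{j≥1} (-1)^j q^{j²}
S : Series
S = diagonal (λ N → altSum N (λ j → q^ (j * j)) ⊕ ⊝ q^ 0)

θ≈1+2S : θ ≈ κ (+ 1) ⊕ κ (+ 2) ⊛ S
θ≈1+2S = mk≈ λ n → begin
  a n ℤ.+ a n ℤ.- z n               ≡⟨ regroup (a n) (z n) ⟩
  z n ℤ.+ + 2 ℤ.* (a n ℤ.- z n)     ≡⟨ cong₂ ℤ._+_ (at (≈-trans q^0≈one (≈-sym κ1≈one)) n) (sym (κ-scale (+ 2) S n)) ⟩
  κ (+ 1) n ℤ.+ (κ (+ 2) ⊛ S) n     ∎
  where
  open ≡-Reasoning
  a : ℕ → ℤ
  a n = altSum n (λ j → q^ (j * j)) n
  z : ℕ → ℤ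
  z = q^ 0
  regroup : ∀ a z → a ℤ.+ a ℤ.- z ≡ z ℤ.+ + 2 ℤ.* (a ℤ.- z)
  regroup = ℤ-Solver.solve-∀

inverse[1+2s]≡1 : ∀ {p s} → p ⊛ (κ (+ 1) ⊕ κ (+ 2) ⊛ s) ≈ κ (+ 1) → p ≡ˢ κ (+ 1) [mod + 2 ]
inverse[1+2s]≡1 {p} {s} inverse = mk≡ˢ (⊝ (s ⊛ p)) (begin
  p                                                                      ≈⟨ identity p s ⟩
  κ (+ 1) ⊕ κ (+ 2) ⊛ ⊝ (s ⊛ p) ⊕ (p ⊛ (κ (+ 1) ⊕ κ (+ 2) ⊛ s) ⊕ ⊝ κ (+ 1))
    ≈⟨ ⊕-cong (≈-refl {κ (+ 1) ⊕ κ (+ 2) ⊛ ⊝ (s ⊛ p)}) (⊕-cong inverse (≈-refl {⊝ κ (+ 1)})) ⟩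
  κ (+ 1) ⊕ κ (+ 2) ⊛ ⊝ (s ⊛ p) ⊕ (κ (+ 1) ⊕ ⊝ κ (+ 1))                  ≈⟨ cancel _ ⟩
  κ (+ 1) ⊕ κ (+ 2) ⊛ ⊝ (s ⊛ p)                                          ∎)
  where
  open ≈-Reasoning
  open SeriesSolver
  identity : ∀ p s → p ≈ κ (+ 1) ⊕ κ (+ 2) ⊛ ⊝ (s ⊛ p) ⊕ (p ⊛ (κ (+ 1) ⊕ κ (+ 2) ⊛ s) ⊕ ⊝ κ (+ 1))
  identity = solve 2 (λ p s → p := con (+ 1) :+ con (+ 2) :* :- (s :* p) :+ (p :* (con (+ 1) :+ con (+ 2) :* s) :- con (+ 1))) ≈-refl
  cancel : ∀ a → a ⊕ (κ (+ 1) ⊕ ⊝ κ (+ 1)) ≈ a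
  cancel = solve 1 (λ a → a :+ (con (+ 1) :- con (+ 1)) := a) ≈-refl

-- Substituting p = 1 - 2sp into itself twice gives p = 1 - 2s + 4s² - 8s³p.
inverse[1+2s]≡1-2s+4s² : ∀ {p s} → p ⊛ (κ (+ 1) ⊕ κ (+ 2) ⊛ s) ≈ κ (+ 1) →
  p ≡ˢ κ (+ 1) ⊕ ⊝ (κ (+ 2) ⊛ s) ⊕ κ (+ 4) ⊛ (s ⊛ s) [mod + 8 ]
inverse[1+2s]≡1-2s+4s² {p} {s} inverse = mk≡ˢ (⊝ (s ⊛ s ⊛ s ⊛ p)) (begin
  p                                                                 ≈⟨ identity p s ⟩
  A ⊕ κ (+ 8) ⊛ ⊝ (s ⊛ s ⊛ s ⊛ p) ⊕ (p ⊛ (κ (+ 1) ⊕ κ (+ 2) ⊛ s) ⊕ ⊝ κ (+ 1)) ⊛ A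
    ≈⟨ ⊕-cong (≈-refl {A ⊕ κ (+ 8) ⊛ ⊝ (s ⊛ s ⊛ s ⊛ p)}) (⊛-cong (⊕-cong inverse (≈-refl {⊝ κ (+ 1)})) (≈-refl {A})) ⟩
  A ⊕ κ (+ 8) ⊛ ⊝ (s ⊛ s ⊛ s ⊛ p) ⊕ (κ (+ 1) ⊕ ⊝ κ (+ 1)) ⊛ A       ≈⟨ cancel _ A ⟩
  A ⊕ κ (+ 8) ⊛ ⊝ (s ⊛ s ⊛ s ⊛ p)                                   ∎)
  where
  open ≈-Reasoning
  open SeriesSolver
  A = κ (+ 1) ⊕ ⊝ (κ (+ 2) ⊛ s) ⊕ κ (+ 4) ⊛ (s ⊛ s)
  identity : ∀ p s →
    p ≈ κ (+ 1) ⊕ ⊝ (κ (+ 2) ⊛ s) ⊕ κ (+ 4) ⊛ (s ⊛ s) ⊕ κ (+ 8) ⊛ ⊝ (s ⊛ s ⊛ s ⊛ p)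
        ⊕ (p ⊛ (κ (+ 1) ⊕ κ (+ 2) ⊛ s) ⊕ ⊝ κ (+ 1)) ⊛ (κ (+ 1) ⊕ ⊝ (κ (+ 2) ⊛ s) ⊕ κ (+ 4) ⊛ (s ⊛ s))
  identity = solve 2 (λ p s →
    p := con (+ 1) :- con (+ 2) :* s :+ con (+ 4) :* (s :* s) :+ con (+ 8) :* :- (s :* s :* s :* p)
         :+ (p :* (con (+ 1) :+ con (+ 2) :* s) :- con (+ 1)) :* (con (+ 1) :- con (+ 2) :* s :+ con (+ 4) :* (s :* s))) ≈-refl
  cancel : ∀ a b → a ⊕ (κ (+ 1) ⊕ ⊝ κ (+ 1)) ⊛ b ≈ a
  cancel = solve 2 (λ a b → a :+ (con (+ 1) :- con (+ 1)) :* b := a) ≈-refl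

-- (A + 8X)(1 + 4Y) = A + 4Y + 8(X + RY) when also A + 8X = 1 + 2R.
⊛-1+4y : ∀ {p a w} → p ≡ˢ a [mod + 8 ] → p ≡ˢ κ (+ 1) [mod + 2 ] → (w≡1 : w ≡ˢ κ (+ 1) [mod + 4 ]) →
  p ⊛ w ≡ˢ a ⊕ κ (+ 4) ⊛ quotient w≡1 [mod + 8 ]
⊛-1+4y {p} {a} {w} (mk≡ˢ x p≈a+8x) (mk≡ˢ r p≈1+2r) (mk≡ˢ y w≈1+4y) = mk≡ˢ (x ⊕ r ⊛ y) (begin
  p ⊛ w                                                       ≈⟨ ⊛-cong (≈-refl {p}) w≈1+4y ⟩
  p ⊛ (κ (+ 1) ⊕ κ (+ 4) ⊛ y)                                 ≈⟨ distribute p y ⟩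
  p ⊕ κ (+ 4) ⊛ (p ⊛ y)                                       ≈⟨ ⊕-cong p≈a+8x (⊛-cong (≈-refl {κ (+ 4)}) (⊛-cong p≈1+2r (≈-refl {y}))) ⟩
  (a ⊕ κ (+ 8) ⊛ x) ⊕ κ (+ 4) ⊛ ((κ (+ 1) ⊕ κ (+ 2) ⊛ r) ⊛ y) ≈⟨ regroup a x r y ⟩
  a ⊕ κ (+ 4) ⊛ y ⊕ κ (+ 8) ⊛ (x ⊕ r ⊛ y)                     ∎)
  where
  open ≈-Reasoning
  open SeriesSolver
  distribute : ∀ p y → p ⊛ (κ (+ 1) ⊕ κ (+ 4) ⊛ y) ≈ p ⊕ κ (+ 4) ⊛ (p ⊛ y)
  distribute = solve 2 (λ p y → p :* (con (+ 1) :+ con (+ 4) :* y) := p :+ con (+ 4) :* (p :* y)) ≈-refl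
  regroup : ∀ a x r y →
    (a ⊕ κ (+ 8) ⊛ x) ⊕ κ (+ 4) ⊛ ((κ (+ 1) ⊕ κ (+ 2) ⊛ r) ⊛ y) ≈ a ⊕ κ (+ 4) ⊛ y ⊕ κ (+ 8) ⊛ (x ⊕ r ⊛ y)
  regroup = solve 4 (λ a x r y →
    (a :+ con (+ 8) :* x) :+ con (+ 4) :* ((con (+ 1) :+ con (+ 2) :* r) :* y)
      := a :+ con (+ 4) :* y :+ con (+ 8) :* (x :+ r :* y)) ≈-refl

quotient-Even : ∀ {s t c} .{{_ : ℤ.NonZero c}} → Even s → Even t → (s≡t : s ≡ˢ t [mod c ]) → Even (quotient s≡t)
quotient-Even {s} {t} {c} s-even t-even (mk≡ˢ u s≈) = mkEven λ k → ℤP.*-cancelˡ-≡ c (u (suc (2 * k))) (+ 0) (begin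
  c ℤ.* u (suc (2 * k))                            ≡⟨ κ-scale c u (suc (2 * k)) ⟨
  (κ c ⊛ u) (suc (2 * k))                          ≡⟨ ℤP.+-identityˡ _ ⟨
  + 0 ℤ.+ (κ c ⊛ u) (suc (2 * k))                  ≡⟨ cong (ℤ._+ (κ c ⊛ u) (suc (2 * k))) (odd-coefficient t-even k) ⟨
  t (suc (2 * k)) ℤ.+ (κ c ⊛ u) (suc (2 * k))      ≡⟨ at s≈ (suc (2 * k)) ⟨
  s (suc (2 * k))                                  ≡⟨ odd-coefficient s-even k ⟩
  + 0                                              ≡⟨ ℤP.*-zeroʳ c ⟨
  c ℤ.* + 0                                        ∎)
  where open ≡-Reasoning

-- The Cauchy square pairs the terms i and n - i, which differ when n is odd.
⊛-self-at-odd : ∀ s k → ∃[ t ] (s ⊛ s) (suc (2 * k)) ≡ t ℤ.+ t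
⊛-self-at-odd s k = sumTo k g , (begin
  sumTo (suc (2 * k)) g                              ≡⟨ cong (λ m → sumTo m g) k+[1+k]≡n ⟨
  sumTo (k + suc k) g                                ≡⟨ sumTo-split k k g ⟩
  sumTo k g ℤ.+ sumTo k (λ i → g (suc k + i))        ≡⟨ cong (ℤ._+_ (sumTo k g)) upperHalf ⟩
  sumTo k g ℤ.+ sumTo k g                            ∎)
  where
  open ≡-Reasoning
  n = suc (2 * k)
  g : ℕ → ℤ
  g i = s i ℤ.* s (n ∸ i)
  k+[1+k]≡n : k + suc k ≡ suc (2 * k)
  k+[1+k]≡n = ℕ-Solver.solve (k ∷ [])
  upperHalf : sumTo k (λ i → g (suc k + i)) ≡ sumTo k g
  upperHalf = trans (sumTo-reverse k _) (sumTo-cong k mirror)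
    where
    mirror : ∀ i → i ≤ k → g (suc k + (k ∸ i)) ≡ g i
    mirror i i≤k = trans (cong₂ ℤ._*_ (cong s j≡n∸i) (cong s n∸j≡i)) (ℤP.*-comm (s (n ∸ i)) (s i))
      where
      d = k ∸ i
      pairing : ∀ i d → suc (i + d) + d + i ≡ suc (2 * (i + d))
      pairing = ℕ-Solver.solve-∀
      j+i≡n : suc k + d + i ≡ n
      j+i≡n = subst (λ x → suc x + d + i ≡ suc (2 * x)) (ℕP.m+[n∸m]≡n i≤k) (pairing i d)
      j≡n∸i : suc k + d ≡ n ∸ i
      j≡n∸i = trans (sym (ℕP.m+n∸n≡m (suc k + d) i)) (cong (_∸ i) j+i≡n)
      n∸j≡i : n ∸ (suc k + d) ≡ i
      n∸j≡i = trans (cong (_∸ (suc k + d)) (sym j+i≡n)) (ℕP.m+n∸m≡n (suc k + d) i)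

-- Squares

IsSquare : ℕ → Set
IsSquare n = ∃[ r ] r * r ≡ n

square? : ∀ n → Dec (IsSquare n)
square? n with ℕP.anyUpTo? (λ r → r * r ℕ.≟ n) (suc n)
... | yes (r , _ , r²≡n) = yes (r , r²≡n)
... | no noRoot          = no λ (r , r²≡n) → noRoot (r , s≤s (root≤ r r²≡n) , r²≡n)
  where
  root≤ : ∀ r → r * r ≡ n → r ≤ n
  root≤ zero    _    = z≤n
  root≤ (suc r) r²≡n = subst (suc r ≤_) r²≡n (ℕP.m≤m*n (suc r) (suc r))

square-injective : ∀ {i j} → i * i ≡ j * j → i ≡ j
square-injective {i} {j} i²≡j² with ℕP.<-cmp i j
... | tri< i<j _ _ = ⊥-elim (ℕP.<⇒≢ (ℕP.*-mono-< i<j i<j) i²≡j²)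
... | tri≈ _ i≡j _ = i≡j
... | tri> _ _ j<i = ⊥-elim (ℕP.<⇒≢ (ℕP.*-mono-< j<i j<i) (sym i²≡j²))

odd-root : ∀ r k → r * r ≡ suc (2 * k) → ∃[ h ] r ≡ suc (2 * h)
odd-root r k r²≡odd with even⊎odd r
... | inj₂ odd-r       = odd-r
... | inj₁ (h , refl) = ⊥-elim (even≢odd (2 * (h * h)) k (trans (square-even h) r²≡odd))
  where
  square-even : ∀ h → 2 * (2 * (h * h)) ≡ 2 * h * (2 * h)
  square-even = ℕ-Solver.solve-∀

prime5 : Prime 5
prime5 = from-yes (prime? 5)

square-25* : ∀ {m} → IsSquare (25 * m) → IsSquare m
square-25* {m} (r , r²≡25m) = root (reduce (euclidsLemma r r prime5 (ND.divides (5 * m) r²≡m*5*5)))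
  where
  r²≡m*5*5 : r * r ≡ 5 * m * 5
  r²≡m*5*5 = trans r²≡25m (ℕ-Solver.solve (m ∷ []))
  root : 5 ∣ r → IsSquare m
  root (ND.divides t refl) = t , ℕP.*-cancelˡ-≡ (t * t) m 25 (trans (regroup t) r²≡25m)
    where
    regroup : ∀ t → 25 * (t * t) ≡ t * 5 * (t * 5)
    regroup = ℕ-Solver.solve-∀

square-5^2α* : ∀ α {m} → IsSquare (5 ^ (2 * α) * m) → IsSquare m
square-5^2α* zero    {m} (r , r²≡m) = r , trans r²≡m (ℕP.+-identityʳ m)
square-5^2α* (suc α) {m} sq = square-5^2α* α (square-25* (subst IsSquare peel sq))
  where
  regroup : ∀ x m → 5 * (5 * x) * m ≡ 25 * (x * m)
  regroup = ℕ-Solver.solve-∀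
  peel : 5 ^ (2 * suc α) * m ≡ 25 * (5 ^ (2 * α) * m)
  peel = trans (cong (λ e → 5 ^ e * m) (ℕP.*-suc 2 α)) (regroup (5 ^ (2 * α)) m)

square-5^2α*⁻¹ : ∀ α {m} → IsSquare m → IsSquare (5 ^ (2 * α) * m)
square-5^2α*⁻¹ α {m} (r , r²≡m) = 5 ^ α * r , (begin
  5 ^ α * r * (5 ^ α * r)     ≡⟨ regroup (5 ^ α) r ⟩
  5 ^ α * 5 ^ α * (r * r)     ≡⟨ cong₂ _*_ (sym (ℕP.^-distribˡ-+-* 5 α α)) r²≡m ⟩
  5 ^ (α + α) * m             ≡⟨ cong (λ e → 5 ^ e * m) α+α≡2α ⟩
  5 ^ (2 * α) * m             ∎)
  where
  open ≡-Reasoning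
  regroup : ∀ p r → p * r * (p * r) ≡ p * p * (r * r)
  regroup = ℕ-Solver.solve-∀
  α+α≡2α : α + α ≡ 2 * α
  α+α≡2α = ℕ-Solver.solve (α ∷ [])

square%5 : ∀ r → (r * r) % 5 ≡ 0 ⊎ (r * r) % 5 ≡ 1 ⊎ (r * r) % 5 ≡ 4
square%5 r = subst (λ x → x ≡ 0 ⊎ x ≡ 1 ⊎ x ≡ 4) (sym (%-distribˡ-* r r 5)) (residues (r % 5) (m%n<n r 5))
  where
  residues : ∀ u → u < 5 → (u * u) % 5 ≡ 0 ⊎ (u * u) % 5 ≡ 1 ⊎ (u * u) % 5 ≡ 4
  residues 0 _ = inj₁ refl
  residues 1 _ = inj₂ (inj₁ refl)
  residues 2 _ = inj₂ (inj₂ refl)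
  residues 3 _ = inj₂ (inj₂ refl)
  residues 4 _ = inj₂ (inj₁ refl)
  residues (suc (suc (suc (suc (suc _))))) (s≤s (s≤s (s≤s (s≤s (s≤s ())))))

nonsquare-mod5 : ∀ c q → c ≡ 2 ⊎ c ≡ 3 → ¬ IsSquare (c + q * 5)
nonsquare-mod5 c q c∈2,3 (r , r²≡) = clash (square%5 r) c∈2,3 (trans (cong (_% 5) r²≡) ([m+kn]%n≡m%n c q 5))
  where
  clash : ∀ {x} → x ≡ 0 ⊎ x ≡ 1 ⊎ x ≡ 4 → c ≡ 2 ⊎ c ≡ 3 → x ≢ c % 5
  clash (inj₁ refl)        (inj₁ refl) ()
  clash (inj₁ refl)        (inj₂ refl) ()
  clash (inj₂ (inj₁ refl)) (inj₁ refl) ()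
  clash (inj₂ (inj₁ refl)) (inj₂ refl) ()
  clash (inj₂ (inj₂ refl)) (inj₁ refl) ()
  clash (inj₂ (inj₂ refl)) (inj₂ refl) ()

Odd : ℕ → Set
Odd n = ∃[ k ] n ≡ suc (2 * k)

Odd-* : ∀ {m n} → Odd m → Odd n → Odd (m * n)
Odd-* (a , refl) (b , refl) = a + b + 2 * a * b , ℕ-Solver.solve (a ∷ b ∷ [])

Odd-^ : ∀ {m} → Odd m → ∀ e → Odd (m ^ e)
Odd-^ odd zero    = 0 , refl
Odd-^ odd (suc e) = Odd-* odd (Odd-^ odd e)

-- Odd coefficients of the generating function

altSum-q^-miss : ∀ L (e : ℕ → ℕ) n → (∀ j → j ≤ L → e j ≢ n) → altSum L (λ j → q^ (e j)) n ≡ + 0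
altSum-q^-miss zero    e n miss = q^k-at-n≢k (e 0) n (miss 0 z≤n ∘ sym)
altSum-q^-miss (suc L) e n miss = cong₂ ℤ._+_ (q^k-at-n≢k (e 0) n (miss 0 z≤n ∘ sym))
  (cong ℤ.-_ (altSum-q^-miss L (e ∘ suc) n (λ j j≤L → miss (suc j) (s≤s j≤L))))

altSum-q^-hit : ∀ L (e : ℕ → ℕ) → (∀ {i j} → e i ≡ e j → i ≡ j) →
  ∀ r → r ≤ L → altSum L (λ j → q^ (e j)) (e r) ≡ ℤ.-1ℤ ℤ.^ r
altSum-q^-hit zero    e injective zero    z≤n = q^k-at-k (e 0)
altSum-q^-hit (suc L) e injective zero    _   = begin
  (q^ e 0) (e 0) ℤ.+ ℤ.- altSum L (λ j → q^ (e (suc j))) (e 0)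
    ≡⟨ cong₂ ℤ._+_ (q^k-at-k (e 0)) (cong ℤ.-_ (altSum-q^-miss L (e ∘ suc) (e 0) (λ j _ e[1+j]≡e0 → ℕP.1+n≢0 (injective e[1+j]≡e0)))) ⟩
  + 1 ℤ.+ ℤ.- + 0 ≡⟨⟩
  + 1 ∎
  where open ≡-Reasoning
altSum-q^-hit (suc L) e injective (suc r) (s≤s r≤L) = begin
  (q^ e 0) (e (suc r)) ℤ.+ ℤ.- altSum L (λ j → q^ (e (suc j))) (e (suc r))
    ≡⟨ cong₂ ℤ._+_ (q^k-at-n≢k (e 0) (e (suc r)) (λ e[1+r]≡e0 → ℕP.1+n≢0 (injective e[1+r]≡e0)))
                   (cong ℤ.-_ (altSum-q^-hit L (e ∘ suc) (ℕP.suc-injective ∘ injective) r r≤L)) ⟩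
  + 0 ℤ.+ ℤ.- (ℤ.-1ℤ ℤ.^ r)   ≡⟨ ℤP.+-identityˡ _ ⟩
  ℤ.- (ℤ.-1ℤ ℤ.^ r)           ≡⟨ ℤP.-1*i≡-i _ ⟨
  ℤ.-1ℤ ℤ.^ suc r             ∎
  where open ≡-Reasoning

S-at-odd-square : ∀ k → IsSquare (suc (2 * k)) → S (suc (2 * k)) ≡ ℤ.-1ℤ
S-at-odd-square k (r , r²≡n) with odd-root r k r²≡n
... | h , refl = begin
  altSum n (λ j → q^ (j * j)) n ℤ.+ ℤ.- (q^ 0) n   ≡⟨ cong₂ ℤ._+_ hit (cong ℤ.-_ (q^k-at-n≢k 0 n (λ ()))) ⟩
  ℤ.-1ℤ ℤ.^ suc (2 * h) ℤ.+ ℤ.- + 0               ≡⟨ ℤP.+-identityʳ _ ⟩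
  ℤ.-1ℤ ℤ.* ℤ.-1ℤ ℤ.^ (2 * h)                     ≡⟨ cong (ℤ._*_ ℤ.-1ℤ) (trans (sym (ℤP.^-*-assoc ℤ.-1ℤ 2 h)) (ℤP.^-zeroˡ h)) ⟩
  ℤ.-1ℤ ℤ.* + 1                                   ≡⟨ ℤP.*-identityʳ ℤ.-1ℤ ⟩
  ℤ.-1ℤ                                           ∎
  where
  open ≡-Reasoning
  n = suc (2 * k)
  hit : altSum n (λ j → q^ (j * j)) n ≡ ℤ.-1ℤ ℤ.^ r
  hit = subst (λ x → altSum n (λ j → q^ (j * j)) x ≡ ℤ.-1ℤ ℤ.^ r) r²≡n
          (altSum-q^-hit n (λ j → j * j) square-injective r (subst (r ≤_) r²≡n (ℕP.m≤m*n r r)))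

S-at-odd-nonsquare : ∀ k → ¬ IsSquare (suc (2 * k)) → S (suc (2 * k)) ≡ + 0
S-at-odd-nonsquare k nonsquare = cong₂ ℤ._+_
  (altSum-q^-miss n (λ j → j * j) n (λ j _ j²≡n → nonsquare (j , j²≡n)))
  (cong ℤ.-_ (q^k-at-n≢k 0 n (λ ())))
  where
  n = suc (2 * k)

pow-f₄²/f₂⁴≡1 : ∀ m → pow f₄²/f₂⁴ m ≡ˢ κ (+ 1) [mod + 4 ]
pow-f₄²/f₂⁴≡1 m = ≡ˢ-respʳ (pow-≡ˢ m f₄²/f₂⁴≡1) (≈-trans (pow-one m) (≈-sym κ1≈one))

f₂/f₁²⊛[1+2S] : f₂/f₁² ⊛ (κ (+ 1) ⊕ κ (+ 2) ⊛ S) ≈ κ (+ 1)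
f₂/f₁²⊛[1+2S] = ≈-trans (⊛-cong (≈-refl {f₂/f₁²}) (≈-sym θ≈1+2S)) (≈-trans f₂/f₁²⊛θ (≈-sym κ1≈one))

abar≡1-2S+4S²+4Y : ∀ m →
  abar (2 * m + 1) ≡ˢ κ (+ 1) ⊕ ⊝ (κ (+ 2) ⊛ S) ⊕ κ (+ 4) ⊛ (S ⊛ S) ⊕ κ (+ 4) ⊛ quotient (pow-f₄²/f₂⁴≡1 m)
                    [mod + 8 ]
abar≡1-2S+4S²+4Y m = ≡ˢ-respˡ (abar-odd≈ m)
  (⊛-1+4y {f₂/f₁²} {κ (+ 1) ⊕ ⊝ (κ (+ 2) ⊛ S) ⊕ κ (+ 4) ⊛ (S ⊛ S)} {pow f₄²/f₂⁴ m}
          (inverse[1+2s]≡1-2s+4s² {f₂/f₁²} {S} f₂/f₁²⊛[1+2S]) (inverse[1+2s]≡1 {f₂/f₁²} {S} f₂/f₁²⊛[1+2S])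
          (pow-f₄²/f₂⁴≡1 m))

abar-odd≡-2S : ∀ m k → + 8 ∣ℤ abar (2 * m + 1) (suc (2 * k)) ℤ.- ℤ.- (+ 2 ℤ.* S (suc (2 * k)))
abar-odd≡-2S m k = subst (+ 8 ∣ℤ_) shift (ℤ∣.∣m∣n⇒∣m+n (≡ˢ⇒∣ (abar≡1-2S+4S²+4Y m) n) (ℤ∣.∣m⇒∣m*n t ℤ∣.∣-refl))
  where
  n = suc (2 * k)
  Y = quotient (pow-f₄²/f₂⁴≡1 m)
  Y-even : Even Y
  Y-even = quotient-Even (pow-Even f₄²/f₂⁴-Even m) (mkEven λ _ → refl) (pow-f₄²/f₂⁴≡1 m)
  t = proj₁ (⊛-self-at-odd S k)
  value : (κ (+ 1) ⊕ ⊝ (κ (+ 2) ⊛ S) ⊕ κ (+ 4) ⊛ (S ⊛ S) ⊕ κ (+ 4) ⊛ Y) n ≡ ℤ.- (+ 2 ℤ.* S n) ℤ.+ + 8 ℤ.* t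
  value = begin
    + 0 ℤ.+ ℤ.- (κ (+ 2) ⊛ S) n ℤ.+ (κ (+ 4) ⊛ (S ⊛ S)) n ℤ.+ (κ (+ 4) ⊛ Y) n
      ≡⟨ cong₂ ℤ._+_ (cong₂ ℤ._+_ (cong (λ x → + 0 ℤ.+ ℤ.- x) (κ-scale (+ 2) S n))
                                  (trans (κ-scale (+ 4) (S ⊛ S) n) (cong (ℤ._*_ (+ 4)) (proj₂ (⊛-self-at-odd S k)))))
                     (trans (κ-scale (+ 4) Y n) (cong (ℤ._*_ (+ 4)) (odd-coefficient Y-even k))) ⟩
    + 0 ℤ.+ ℤ.- (+ 2 ℤ.* S n) ℤ.+ + 4 ℤ.* (t ℤ.+ t) ℤ.+ + 4 ℤ.* + 0
      ≡⟨ simplify (S n) t ⟩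
    ℤ.- (+ 2 ℤ.* S n) ℤ.+ + 8 ℤ.* t ∎
    where
    open ≡-Reasoning
    simplify : ∀ s t → + 0 ℤ.+ ℤ.- (+ 2 ℤ.* s) ℤ.+ + 4 ℤ.* (t ℤ.+ t) ℤ.+ + 4 ℤ.* + 0 ≡ ℤ.- (+ 2 ℤ.* s) ℤ.+ + 8 ℤ.* t
    simplify = ℤ-Solver.solve-∀
  shift : abar (2 * m + 1) n ℤ.- (κ (+ 1) ⊕ ⊝ (κ (+ 2) ⊛ S) ⊕ κ (+ 4) ⊛ (S ⊛ S) ⊕ κ (+ 4) ⊛ Y) n ℤ.+ + 8 ℤ.* t
          ≡ abar (2 * m + 1) n ℤ.- ℤ.- (+ 2 ℤ.* S n)
  shift = trans (cong (λ v → abar (2 * m + 1) n ℤ.- v ℤ.+ + 8 ℤ.* t) value) (cancel (abar (2 * m + 1) n) (S n) t)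
    where
    cancel : ∀ a s t → a ℤ.- (ℤ.- (+ 2 ℤ.* s) ℤ.+ + 8 ℤ.* t) ℤ.+ + 8 ℤ.* t ≡ a ℤ.- ℤ.- (+ 2 ℤ.* s)
    cancel = ℤ-Solver.solve-∀

abar-odd-square : ∀ m {N} → Odd N → IsSquare N → + 8 ∣ℤ abar (2 * m + 1) N ℤ.- + 2
abar-odd-square m (k , refl) square =
  subst (λ s → + 8 ∣ℤ abar (2 * m + 1) (suc (2 * k)) ℤ.- ℤ.- (+ 2 ℤ.* s)) (S-at-odd-square k square) (abar-odd≡-2S m k)

abar-odd-nonsquare : ∀ m {N} → Odd N → ¬ IsSquare N → + 8 ∣ℤ abar (2 * m + 1) N ℤ.- + 0
abar-odd-nonsquare m (k , refl) nonsquare =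
  subst (λ s → + 8 ∣ℤ abar (2 * m + 1) (suc (2 * k)) ℤ.- ℤ.- (+ 2 ℤ.* s)) (S-at-odd-nonsquare k nonsquare) (abar-odd≡-2S m k)

∣-common : ∀ {k x y c} → k ∣ℤ x ℤ.- c → k ∣ℤ y ℤ.- c → k ∣ℤ x ℤ.- y
∣-common {k} {x} {y} {c} k∣x-c k∣y-c = subst (k ∣ℤ_) (cancel x y c) (ℤ∣.∣m∣n⇒∣m-n k∣x-c k∣y-c)
  where
  cancel : ∀ x y c → (x ℤ.- c) ℤ.- (y ℤ.- c) ≡ x ℤ.- y
  cancel = ℤ-Solver.solve-∀

Odd-5^2α : ∀ α → Odd (5 ^ (2 * α))
Odd-5^2α α = Odd-^ (2 , refl) (2 * α)

abar-5^2α* : ∀ α m {M} → Odd M → abar (2 * m + 1) (5 ^ (2 * α) * M) ≡ abar (2 * m + 1) M [mod 8 ]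
abar-5^2α* α m {M} odd = ℤ∣.∣⇒∣ᵤ (both-congruent (square? M))
  where
  both-congruent : Dec (IsSquare M) → + 8 ∣ℤ abar (2 * m + 1) (5 ^ (2 * α) * M) ℤ.- abar (2 * m + 1) M
  both-congruent (yes square)   = ∣-common {x = abar (2 * m + 1) (5 ^ (2 * α) * M)} {abar (2 * m + 1) M} {+ 2}
                                           (abar-odd-square m (Odd-* (Odd-5^2α α) odd) (square-5^2α*⁻¹ α square))
                                           (abar-odd-square m odd square)
  both-congruent (no nonsquare) = ∣-common {x = abar (2 * m + 1) (5 ^ (2 * α) * M)} {abar (2 * m + 1) M} {+ 0}
                                           (abar-odd-nonsquare m (Odd-* (Odd-5^2α α) odd) (nonsquare ∘ square-5^2α* α))
                                           (abar-odd-nonsquare m odd nonsquare)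

abar-5^2α*-nonsquare : ∀ α m {M} → Odd M → ¬ IsSquare M → abar (2 * m + 1) (5 ^ (2 * α) * M) ≡ + 0 [mod 8 ]
abar-5^2α*-nonsquare α m odd nonsquare =
  ℤ∣.∣⇒∣ᵤ (abar-odd-nonsquare m (Odd-* (Odd-5^2α α) odd) (nonsquare ∘ square-5^2α* α))

mainTheorem2 : (α m n : ℕ) →
    (abar (2 * m + 1) (8 * 5 ^ (2 * α) * n + 5 ^ (2 * α)) ≡ abar (2 * m + 1) (8 * n + 1) [mod 8 ])
    × (abar (2 * m + 1) (8 * 5 ^ (2 * α + 1) * n + 17 * 5 ^ (2 * α)) ≡ + 0 [mod 8 ])
    × (abar (2 * m + 1) (8 * 5 ^ (2 * α + 1) * n + 33 * 5 ^ (2 * α)) ≡ + 0 [mod 8 ])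
mainTheorem2 α m n =
    reindex {r = abar (2 * m + 1) (8 * n + 1)} (index₁ x n) (abar-5^2α* α m (4 * n , odd₁ n))
  , reindex {r = + 0} (index₂ 2 3) (abar-5^2α*-nonsquare α m (20 * n + 8 , odd₂ n) (nonsquare-mod5 2 (8 * n + 3) (inj₁ refl)))
  , reindex {r = + 0} (index₂ 3 6) (abar-5^2α*-nonsquare α m (20 * n + 16 , odd₃ n) (nonsquare-mod5 3 (8 * n + 6) (inj₂ refl)))
  where
  x = 5 ^ (2 * α)
  reindex : ∀ {N N′ r} → N′ ≡ N → abar (2 * m + 1) N ≡ r [mod 8 ] → abar (2 * m + 1) N′ ≡ r [mod 8 ]
  reindex refl ā≡r = ā≡r
  index₁ : ∀ x n → 8 * x * n + x ≡ x * (8 * n + 1)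
  index₁ = ℕ-Solver.solve-∀
  regroup : ∀ x n r d → 8 * (x * (5 * 1)) * n + (5 * r + d) * x ≡ x * (d + (8 * n + r) * 5)
  regroup = ℕ-Solver.solve-∀
  index₂ : ∀ d r → 8 * 5 ^ (2 * α + 1) * n + (5 * r + d) * x ≡ x * (d + (8 * n + r) * 5)
  index₂ d r = trans (cong (λ y → 8 * y * n + (5 * r + d) * x) (ℕP.^-distribˡ-+-* 5 (2 * α) 1)) (regroup x n r d)
  odd₁ : ∀ n → 8 * n + 1 ≡ suc (2 * (4 * n))
  odd₁ = ℕ-Solver.solve-∀
  odd₂ : ∀ n → 2 + (8 * n + 3) * 5 ≡ suc (2 * (20 * n + 8))
  odd₂ = ℕ-Solver.solve-∀
  odd₃ : ∀ n → 3 + (8 * n + 6) * 5 ≡ suc (2 * (20 * n + 16))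
  odd₃ = ℕ-Solver.solve-∀
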